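{- A graph $G$ is $5$-$\gamma_{tR}$-edge-critical if and only if either (i) $G$ is $3$-$\gamma_t$-edge-critical and there exist a minimum dominating set $S$ and a minimum total dominating set $T$ of $G$ with $S\subset T$, or (ii) $G=K_2\cup K_n$ for some $n\geq 3$, in which case $G$ is $4$-$\gamma_t$-edge-supercritical.
   Context: All graphs are finite and simple. A dominating set of $G$ is a set $S$ such that every vertex outside $S$ has a neighbour in $S$; $\gamma(G)$ is its minimum size. For a graph with no isolated vertices, a total dominating set is a set $T$ such that every vertex has a neighbour in $T$; $\gamma_t(G)$ is its minimum size. A total Roman dominating function (TRD-function) on a graph $G$ with no isolated vertices is a function $f:V(G)\to\{0,1,2\}$ such that every vertex $v$ with $f(v)=0$ is adjacent to some $u$ with $f(u)=2$, and the subgraph induced by $\{w:f(w)>0\}$ has no isolated vertices; its weight is $\sum_v f(v)$ and $\gamma_{tR}(G)$ is the minimum weight. For a graph $G$ with no isolated vertices: $G$ is $k$-$\gamma_{tR}$-edge-critical if $\gamma_{tR}(G)=k$, $E(\overline{G})\neq\emptyset$ and $\gamma_{tR}(G+e)<\gamma_{tR}(G)$ for every $e\in E(\overline{G})$; $G$ is $k$-$\gamma_t$-edge-critical if $\gamma_t(G)=k$, $E(\overline{G})\neq\emptyset$ and $\gamma_t(G+e)<\gamma_t(G)$ for every $e\in E(\overline{G})$; $G$ is $k$-$\gamma_t$-edge-supercritical if $\gamma_t(G)=k$, $E(\overline{G})\neq\emptyset$ and $\gamma_t(G+e)=\gamma_t(G)-2$ for every $e\in E(\overline{G})$. -}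

module Defs where

open import Data.Nat using (ℕ; zero; suc; _+_; _∸_; _≤_; _<_; _<?_)
open import Data.Bool using (Bool; true; false; _∨_; _∧_; not; _xor_)
open import Data.Fin using (Fin; toℕ; _≟_)
open import Data.Fin.Subset using (Subset; _∈_; _∉_; ∣_∣)
open import Data.Vec using (tabulate; sum)
open import Data.Product using (Σ; ∃; ∃-syntax; _×_; _,_)
open import Relation.Nullary using (¬_; ⌊_⌋; yes; no)
open import Data.Empty using (⊥-elim)
open import Data.Bool.Properties using (∨-comm; ∧-comm)
open import Relation.Binary.PropositionalEquality using (_≡_; _≢_; refl; trans; cong₂)
open import Function.Bundles using (_↔_; Inverse)

record Graph (n : ℕ) : Set where
  field
    Adj   : Fin n → Fin n → Bool
    sym   : ∀ i j → Adj i j ≡ Adj j i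
    irrefl : ∀ i → Adj i i ≡ false
open Graph public

_~[_]_ : ∀ {n} → Fin n → Graph n → Fin n → Set
u ~[ G ] v = Adj G u v ≡ true

NoIsolated : ∀ {n} → Graph n → Set
NoIsolated {n} G = ∀ (v : Fin n) → ∃[ u ] (v ~[ G ] u)

-- non-edges of G (edges of the complement): unordered pairs represented by
-- ordered pairs of distinct non-adjacent vertices
NonEdge : ∀ {n} → Graph n → Set
NonEdge {n} G = Σ (Fin n) λ u → Σ (Fin n) λ v → (u ≢ v) × (Adj G u v ≡ false)

addEdge : ∀ {n} (G : Graph n) → NonEdge G → Graph n
addEdge {n} G (u , v , u≢v , _) = record
  { Adj = A ; sym = symA ; irrefl = irrA }
  where
  isE : Fin n → Fin n → Bool
  isE i j = (⌊ i ≟ u ⌋ ∧ ⌊ j ≟ v ⌋) ∨ (⌊ i ≟ v ⌋ ∧ ⌊ j ≟ u ⌋)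
  A : Fin n → Fin n → Bool
  A i j = Adj G i j ∨ isE i j
  isE-sym : ∀ i j → isE i j ≡ isE j i
  isE-sym i j =
    trans (∨-comm (⌊ i ≟ u ⌋ ∧ ⌊ j ≟ v ⌋) (⌊ i ≟ v ⌋ ∧ ⌊ j ≟ u ⌋))
          (cong₂ _∨_ (∧-comm ⌊ i ≟ v ⌋ ⌊ j ≟ u ⌋) (∧-comm ⌊ i ≟ u ⌋ ⌊ j ≟ v ⌋))
  symA : ∀ i j → A i j ≡ A j i
  symA i j = cong₂ _∨_ (sym G i j) (isE-sym i j)
  isE-irr : ∀ i → isE i i ≡ false
  isE-irr i with i ≟ u | i ≟ v
  ... | yes refl | yes refl = ⊥-elim (u≢v refl)
  ... | yes _ | no _ = refl
  ... | no _ | yes _ = refl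
  ... | no _ | no _ = refl
  irrA : ∀ i → A i i ≡ false
  irrA i = cong₂ _∨_ (irrefl G i) (isE-irr i)

Dominating : ∀ {n} → Graph n → Subset n → Set
Dominating {n} G S = ∀ (v : Fin n) → v ∉ S → ∃[ u ] (u ∈ S × u ~[ G ] v)

TotalDominating : ∀ {n} → Graph n → Subset n → Set
TotalDominating {n} G T = ∀ (v : Fin n) → ∃[ u ] (u ∈ T × u ~[ G ] v)

MinDominating : ∀ {n} → Graph n → Subset n → Set
MinDominating G S = Dominating G S × (∀ S′ → Dominating G S′ → ∣ S ∣ ≤ ∣ S′ ∣)

MinTotalDominating : ∀ {n} → Graph n → Subset n → Set
MinTotalDominating G T =
  TotalDominating G T × (∀ T′ → TotalDominating G T′ → ∣ T ∣ ≤ ∣ T′ ∣)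

Isγt : ∀ {n} → Graph n → ℕ → Set
Isγt G k = NoIsolated G × ∃[ T ] (MinTotalDominating G T × ∣ T ∣ ≡ k)

val : Fin 3 → ℕ
val = toℕ

IsTRDF : ∀ {n} → Graph n → (Fin n → Fin 3) → Set
IsTRDF {n} G f =
  (∀ (v : Fin n) → val (f v) ≡ 0 → ∃[ u ] (u ~[ G ] v × val (f u) ≡ 2)) ×
  (∀ (v : Fin n) → val (f v) ≢ 0 → ∃[ u ] (v ~[ G ] u × val (f u) ≢ 0))

weight : ∀ {n} → (Fin n → Fin 3) → ℕ
weight f = sum (tabulate (λ v → val (f v)))

IsγtR : ∀ {n} → Graph n → ℕ → Set
IsγtR G k = NoIsolated G ×
  ∃[ f ] (IsTRDF G f × weight f ≡ k × (∀ g → IsTRDF G g → k ≤ weight g))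

TRCritical : ℕ → ∀ {n} → Graph n → Set
TRCritical k G = NoIsolated G × IsγtR G k × NonEdge G ×
  (∀ (e : NonEdge G) → ∃[ k′ ] (IsγtR (addEdge G e) k′ × k′ < k))

TCritical : ℕ → ∀ {n} → Graph n → Set
TCritical k G = NoIsolated G × Isγt G k × NonEdge G ×
  (∀ (e : NonEdge G) → ∃[ k′ ] (Isγt (addEdge G e) k′ × k′ < k))

TSupercritical : ℕ → ∀ {n} → Graph n → Set
TSupercritical k G = NoIsolated G × Isγt G k × NonEdge G ×
  (∀ (e : NonEdge G) → Isγt (addEdge G e) (k ∸ 2))

-- K₂ ∪ Kₘ on vertex set Fin (2 + m): vertices 0,1 form the K₂

side : ∀ {m} → Fin (2 + m) → Bool
side i = ⌊ toℕ i <? 2 ⌋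

K2∪K-Adj : ∀ m → Fin (2 + m) → Fin (2 + m) → Bool
K2∪K-Adj m i j = not ⌊ i ≟ j ⌋ ∧ not (side i xor side j)

IsK2∪K : ∀ {n} → Graph n → ℕ → Set
IsK2∪K {n} G m = Σ (Fin n ↔ Fin (2 + m)) λ φ →
  ∀ i j → Adj G i j ≡ K2∪K-Adj m (Inverse.to φ i) (Inverse.to φ j)

-- A TRDF of weight at most 4 is constantly 1 or puts 2 on the end of a dominating edge, so for
-- n ≥ 5, γtR ≥ 5 means that there is no dominating edge, and 5-γtR-edge-criticality means
-- moreover γtR = 5 and a dominating edge in every G + e.
-- Given such a G, take a minimum TRDF valued 2 at some v (built by hand when n = 5 and the
-- minimum is constantly 1) and a positive partner a of v. As {v, a} is not a dominating edge
-- and the weight is 5, there are at most four positive vertices, and a case analysis finds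
-- either x, y, z with {x, y} dominating and {x, y, z} totally dominating, giving (i), or an
-- isolated edge b c; then a non-edge x y away from b c would leave G + x y without a dominating
-- edge, so G is K₂ ∪ Kₙ₋₂.
-- Conversely, 2 on S and 1 on T ∖ S has weight 5, and in K₂ ∪ Kₘ every added edge joins the two
-- cliques and is dominating.

module Submission where

open import Defs hiding (sym)
open import Algebra.Properties.CommutativeSemigroup using (interchange; x∙yz≈y∙xz)
open import Data.Bool using (Bool; true; false; if_then_else_)
import Data.Bool as Bool
open import Data.Bool.Properties using (¬-not; ∨-zeroʳ; ∨-identityʳ; ⇔→≡)
open import Data.Empty using (⊥; ⊥-elim)
open import Data.Fin using (Fin; zero; suc)
open import Data.Fin.Patterns using (0F; 1F; 2F)
open import Data.Fin.Permutation using (inverseˡ; inverseʳ; transpose; _∘ₚ_; _⟨$⟩ʳ_)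
open import Data.Fin.Properties using (_≟_; any?; all?)
open import Data.Fin.Subset using (Subset; _∈_; _∉_; ∣_∣; _⊆_; _⊂_; ⊤)
open import Data.Fin.Subset.Properties using (∈⊤; ∣⊤∣≡n; p⊂q⇒p⊆q; p⊂q⇒∣p∣<∣q∣) renaming (_∈?_ to _∈ₛ?_)
open import Data.List using (List; []; _∷_; _++_; length; map)
open import Data.List.Membership.Propositional using () renaming (_∈_ to _∈ₗ_; _∉_ to _∉ₗ_)
open import Data.List.Membership.Propositional.Properties using (∈-++⁺ˡ; ∈-++⁺ʳ)
open import Data.List.Relation.Binary.Pointwise using (Pointwise; []; _∷_)
open import Data.List.Relation.Unary.All using (All; []; _∷_)
import Data.List.Relation.Unary.All as All
open import Data.List.Relation.Unary.All.Properties using (¬Any⇒All¬)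
open import Data.List.Relation.Unary.AllPairs using ([]; _∷_)
open import Data.List.Relation.Unary.Any using (here; there)
import Data.List.Relation.Unary.Any as Any
open import Data.List.Relation.Unary.Unique.Propositional using (Unique)
open import Data.Nat using (ℕ; zero; suc; _+_; _*_; _≤_; _<_; z≤n; s≤s)
open import Data.Nat.Induction using (<-wellFounded)
open import Data.Nat.ListAction using (sum)
open import Data.Nat.Properties hiding (_≟_)
open import Data.Nat.Properties using () renaming (_≟_ to _≟ℕ_)
open import Data.Product using (∃; ∃-syntax; _×_; _,_; proj₁; proj₂)
open import Data.Sum using (_⊎_; inj₁; inj₂; [_,_]′)
import Data.Sum
import Data.Vec as Vec
open import Data.Vec using ([]; _∷_)
import Data.Vec.Functional as Vector
open import Data.Vec.Properties using (tabulate-cong; lookup∘tabulate; []=⇒lookup; lookup⇒[]=)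
open import Function using (_∘_; const)
open import Function.Bundles using (_⇔_; mk⇔; _↔_; Inverse; Equivalence)
open import Induction.WellFounded using (Acc; acc)
open import Relation.Binary.PropositionalEquality
  using (_≡_; _≢_; refl; sym; trans; cong; cong₂; subst; ≢-sym; module ≡-Reasoning)
open import Relation.Nullary using (¬_; ¬?; Dec; yes; no; does; contradiction)
open import Relation.Nullary.Decidable
  using (dec-true; dec-false; decidable-stable; _×-dec_; _→-dec_; _⊎-dec_)

-- Finite sums and cardinalities

∑ : ∀ {n} → (Fin n → ℕ) → ℕ
∑ h = Vec.sum (Vec.tabulate h)

∑-cong : ∀ {n} {g h : Fin n → ℕ} → (∀ u → g u ≡ h u) → ∑ g ≡ ∑ h
∑-cong g≗h = cong Vec.sum (tabulate-cong g≗h)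

∑-+ : ∀ {n} (g h : Fin n → ℕ) → ∑ (λ u → g u + h u) ≡ ∑ g + ∑ h
∑-+ {zero}  g h = refl
∑-+ {suc n} g h = begin
  (g zero + h zero) + ∑ (λ u → g (suc u) + h (suc u))
    ≡⟨ cong (g zero + h zero +_) (∑-+ (g ∘ suc) (h ∘ suc)) ⟩
  (g zero + h zero) + (∑ (g ∘ suc) + ∑ (h ∘ suc))
    ≡⟨ interchange +-commutativeSemigroup (g zero) (h zero) _ _ ⟩
  (g zero + ∑ (g ∘ suc)) + (h zero + ∑ (h ∘ suc)) ∎
  where open ≡-Reasoning

∑-zero : ∀ {n} (h : Fin n → ℕ) → (∀ u → h u ≡ 0) → ∑ h ≡ 0
∑-zero {zero}  h h≗0 = refl
∑-zero {suc n} h h≗0 = cong₂ _+_ (h≗0 zero) (∑-zero (h ∘ suc) (h≗0 ∘ suc))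

without : ∀ {n} → Fin n → (Fin n → ℕ) → Fin n → ℕ
without v h u = if does (u ≟ v) then 0 else h u

without-≢ : ∀ {n} {v u : Fin n} (h : Fin n → ℕ) → u ≢ v → without v h u ≡ h u
without-≢ {v = v} {u} h u≢v with u ≟ v
... | yes u≡v = contradiction u≡v u≢v
... | no _    = refl

without-≤ : ∀ {n} (v : Fin n) (h : Fin n → ℕ) u → without v h u ≤ h u
without-≤ v h u with u ≟ v
... | yes _ = z≤n
... | no _  = ≤-refl

∑-without : ∀ {n} (h : Fin n → ℕ) v → ∑ h ≡ h v + ∑ (without v h)
∑-without {suc n} h zero =
  cong (h zero +_) (∑-cong λ u → sym (without-≢ {v = zero} {suc u} h λ ()))
∑-without {suc n} h (suc v) = begin
  h zero + ∑ (h ∘ suc)                           ≡⟨ cong (h zero +_) (∑-without (h ∘ suc) v) ⟩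
  h zero + (h (suc v) + ∑ (without v (h ∘ suc))) ≡⟨ x∙yz≈y∙xz +-commutativeSemigroup (h zero) (h (suc v)) _ ⟩
  h (suc v) + (h zero + ∑ (without v (h ∘ suc))) ∎
  where open ≡-Reasoning

sumOver : ∀ {n} → (Fin n → ℕ) → List (Fin n) → ℕ
sumOver h L = sum (map h L)

sumOver-cong : ∀ {n} {g h : Fin n → ℕ} {L} → All (λ u → g u ≡ h u) L → sumOver g L ≡ sumOver h L
sumOver-cong []       = refl
sumOver-cong (e ∷ es) = cong₂ _+_ e (sumOver-cong es)

sumOver≤∑ : ∀ {n} (h : Fin n → ℕ) {L} → Unique L → sumOver h L ≤ ∑ h
sumOver≤∑ h {[]}    []             = z≤n
sumOver≤∑ h {v ∷ L} (v∉L ∷ unique) = begin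
  h v + sumOver h L             ≡⟨ cong (h v +_) (sumOver-cong (All.map (λ v≢u → sym (without-≢ h (≢-sym v≢u))) v∉L)) ⟩
  h v + sumOver (without v h) L ≤⟨ +-monoʳ-≤ (h v) (sumOver≤∑ (without v h) unique) ⟩
  h v + ∑ (without v h)         ≡⟨ sym (∑-without h v) ⟩
  ∑ h                           ∎
  where open ≤-Reasoning

∑≤length : ∀ {n} (h : Fin n → ℕ) L → (∀ u → h u ≤ 1) → (∀ u → u ∉ₗ L → h u ≡ 0) → ∑ h ≤ length L
∑≤length h []      h≤1 outside≡0 = ≤-reflexive (∑-zero h λ u → outside≡0 u λ ())
∑≤length h (v ∷ L) h≤1 outside≡0 = begin
  ∑ h                   ≡⟨ ∑-without h v ⟩
  h v + ∑ (without v h) ≤⟨ +-mono-≤ (h≤1 v) (∑≤length (without v h) L (λ u → ≤-trans (without-≤ v h u) (h≤1 u))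
                                                            outside≡0′) ⟩
  suc (length L)        ∎
  where
  open ≤-Reasoning
  outside≡0′ : ∀ u → u ∉ₗ L → without v h u ≡ 0
  outside≡0′ u u∉L with u ≟ v
  ... | yes _   = refl
  ... | no u≢v = outside≡0 u λ { (here u≡v) → u≢v u≡v ; (there u∈L) → u∉L u∈L }

𝟙 : ∀ {n} → Subset n → Fin n → ℕ
𝟙 S u = if Vec.lookup S u then 1 else 0

∣∣≡∑𝟙 : ∀ {n} (S : Subset n) → ∣ S ∣ ≡ ∑ (𝟙 S)
∣∣≡∑𝟙 []          = refl
∣∣≡∑𝟙 (true ∷ S)  = cong suc (∣∣≡∑𝟙 S)
∣∣≡∑𝟙 (false ∷ S) = ∣∣≡∑𝟙 S

𝟙-∈ : ∀ {n} {S : Subset n} {u} → u ∈ S → 𝟙 S u ≡ 1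
𝟙-∈ u∈S rewrite []=⇒lookup u∈S = refl

𝟙-∉ : ∀ {n} (S : Subset n) u → u ∉ S → 𝟙 S u ≡ 0
𝟙-∉ S u u∉S with Vec.lookup S u in eq
... | true  = contradiction (lookup⇒[]= u S eq) u∉S
... | false = refl

𝟙≤1 : ∀ {n} (S : Subset n) u → 𝟙 S u ≤ 1
𝟙≤1 S u with Vec.lookup S u
... | true  = ≤-refl
... | false = z≤n

length≤∣∣ : ∀ {n} {S : Subset n} {L} → Unique L → All (_∈ S) L → length L ≤ ∣ S ∣
length≤∣∣ {S = S} {L} unique L⊆S = begin
  length L        ≡⟨ length≡sumOver L⊆S ⟩
  sumOver (𝟙 S) L ≤⟨ sumOver≤∑ (𝟙 S) unique ⟩
  ∑ (𝟙 S)         ≡⟨ sym (∣∣≡∑𝟙 S) ⟩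
  ∣ S ∣           ∎
  where
  open ≤-Reasoning
  length≡sumOver : ∀ {L} → All (_∈ S) L → length L ≡ sumOver (𝟙 S) L
  length≡sumOver []            = refl
  length≡sumOver (u∈S ∷ L⊆S) = cong₂ _+_ (sym (𝟙-∈ u∈S)) (length≡sumOver L⊆S)

∣∣≤length : ∀ {n} {S : Subset n} L → (∀ u → u ∈ S → u ∈ₗ L) → ∣ S ∣ ≤ length L
∣∣≤length {S = S} L S⊆L = begin
  ∣ S ∣   ≡⟨ ∣∣≡∑𝟙 S ⟩
  ∑ (𝟙 S) ≤⟨ ∑≤length (𝟙 S) L (𝟙≤1 S) (λ u u∉L → 𝟙-∉ S u (u∉L ∘ S⊆L u)) ⟩
  length L ∎
  where open ≤-Reasoning

length≤n : ∀ {n} {L : List (Fin n)} → Unique L → length L ≤ n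
length≤n {n} {L} unique = subst (length L ≤_) (∣⊤∣≡n n) (length≤∣∣ {S = ⊤} unique (All.universal (λ _ → ∈⊤) L))

n≤length : ∀ {n} (L : List (Fin n)) → (∀ u → u ∈ₗ L) → n ≤ length L
n≤length {n} L all∈L = subst (_≤ length L) (∣⊤∣≡n n) (∣∣≤length {S = ⊤} L λ u _ → all∈L u)

_∈ₗ?_ : ∀ {n} (u : Fin n) L → Dec (u ∈ₗ L)
u ∈ₗ? L = Any.any? (u ≟_) L

fresh : ∀ {n} (L : List (Fin n)) → length L < n → ∃[ u ] u ∉ₗ L
fresh L L<n with any? (λ u → ¬? (u ∈ₗ? L))
... | yes found = found
... | no none   = contradiction (n≤length L λ u → decidable-stable (u ∈ₗ? L) (λ u∉L → none (u , u∉L))) (<⇒≱ L<n)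

covered : ∀ {n} {L : List (Fin n)} → Unique L → n ≤ length L → ∀ u → u ∈ₗ L
covered {L = L} unique n≤L u = decidable-stable (u ∈ₗ? L) λ u∉L →
  <⇒≱ (s≤s n≤L) (length≤n (¬Any⇒All¬ L u∉L ∷ unique))

-- opaque, so that unification can recover L from ⟦ L ⟧
opaque
  ⟦_⟧ : ∀ {n} → List (Fin n) → Subset n
  ⟦ L ⟧ = Vec.tabulate (λ u → does (u ∈ₗ? L))

  ∈⟦⟧⁺ : ∀ {n} {L} {u : Fin n} → u ∈ₗ L → u ∈ ⟦ L ⟧
  ∈⟦⟧⁺ {L = L} {u} u∈L = lookup⇒[]= u ⟦ L ⟧ (trans (lookup∘tabulate _ u) (dec-true (u ∈ₗ? L) u∈L))

  ∈⟦⟧⁻ : ∀ {n} {L} {u : Fin n} → u ∈ ⟦ L ⟧ → u ∈ₗ L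
  ∈⟦⟧⁻ {L = L} {u} u∈⟦L⟧ = decidable-stable (u ∈ₗ? L) λ u∉L →
    contradiction (trans (sym ([]=⇒lookup u∈⟦L⟧)) (trans (lookup∘tabulate _ u) (dec-false (u ∈ₗ? L) u∉L))) λ ()

∣⟦⟧∣ : ∀ {n} {L : List (Fin n)} → Unique L → ∣ ⟦ L ⟧ ∣ ≡ length L
∣⟦⟧∣ {L = L} unique = ≤-antisym (∣∣≤length L λ u → ∈⟦⟧⁻) (length≤∣∣ unique (All.tabulate ∈⟦⟧⁺))

-- Adjacency and dominating edges

module Adjacency {n} (G : Graph n) where

  infix 4 _~_
  _~_ : Fin n → Fin n → Set
  u ~ v = u ~[ G ] v

  _~?_ : ∀ u v → Dec (u ~ v)
  u ~? v = Adj G u v Bool.≟ true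

  ~-sym : ∀ {u v} → u ~ v → v ~ u
  ~-sym {u} {v} u~v = trans (Graph.sym G v u) u~v

  ~-irrefl : ∀ {u} → ¬ u ~ u
  ~-irrefl {u} u~u with trans (sym u~u) (irrefl G u)
  ... | ()

  ~⇒≢ : ∀ {u v} → u ~ v → u ≢ v
  ~⇒≢ u~v refl = ~-irrefl u~v

  ≁⇒nonEdge : ∀ {u v} → u ≢ v → ¬ u ~ v → NonEdge G
  ≁⇒nonEdge {u} {v} u≢v u≁v = u , v , u≢v , ¬-not u≁v

module _ {n} (G : Graph n) where
  open Adjacency G

  addEdge-⊇ : ∀ e {x y} → x ~ y → x ~[ addEdge G e ] y
  addEdge-⊇ e {x} {y} x~y rewrite x~y = refl

  addEdge-new : ∀ e → proj₁ e ~[ addEdge G e ] proj₁ (proj₂ e)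
  addEdge-new (u , v , _ , _) with u ≟ u | v ≟ v
  ... | yes _   | yes _   = ∨-zeroʳ (Adj G u v)
  ... | no u≢u  | _       = contradiction refl u≢u
  ... | _       | no v≢v  = contradiction refl v≢v

  addEdge-old : ∀ e {x y} → x ≢ proj₁ e → x ≢ proj₁ (proj₂ e) → x ~[ addEdge G e ] y → x ~ y
  addEdge-old (u , v , _ , _) {x} {y} x≢u x≢v x~y with x ≟ u | x ≟ v
  ... | yes x≡u | _       = contradiction x≡u x≢u
  ... | no _    | yes x≡v = contradiction x≡v x≢v
  ... | no _    | no _    = trans (sym (∨-identityʳ (Adj G x y))) x~y

  addEdge-noIsolated : ∀ e → NoIsolated G → NoIsolated (addEdge G e)
  addEdge-noIsolated e noIsolated x = let (y , x~y) = noIsolated x in y , addEdge-⊇ e x~y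

DominatingEdge : ∀ {n} → Graph n → Fin n → Fin n → Set
DominatingEdge G p q = p ~[ G ] q × (∀ x → p ~[ G ] x ⊎ q ~[ G ] x)

HasDominatingEdge : ∀ {n} → Graph n → Set
HasDominatingEdge G = ∃[ p ] ∃[ q ] DominatingEdge G p q

NoDominatingEdge : ∀ {n} → Graph n → Set
NoDominatingEdge G = ∀ p q → ¬ DominatingEdge G p q

Universal : ∀ {n} → Graph n → Fin n → Set
Universal G v = ∀ x → x ≢ v → v ~[ G ] x

module _ {n} (G : Graph n) where
  open Adjacency G

  undominated-vertex : ∀ {p q} → ¬ DominatingEdge G p q → p ~ q → ∃[ w ] (¬ p ~ w × ¬ q ~ w)
  undominated-vertex {p} {q} ¬dominating p~q with any? (λ w → ¬? (p ~? w) ×-dec ¬? (q ~? w))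
  ... | yes found = found
  ... | no none   = contradiction (p~q , dominated) ¬dominating
    where
    dominated : ∀ w → p ~ w ⊎ q ~ w
    dominated w with p ~? w | q ~? w
    ... | yes p~w | _       = inj₁ p~w
    ... | no _    | yes q~w = inj₂ q~w
    ... | no p≁w  | no q≁w  = contradiction (w , p≁w , q≁w) none

  dominatingEdge⇒totalDominating : ∀ {p q} → DominatingEdge G p q → TotalDominating G ⟦ p ∷ q ∷ [] ⟧
  dominatingEdge⇒totalDominating {p} {q} (_ , dominated) x with dominated x
  ... | inj₁ p~x = p , ∈⟦⟧⁺ (here refl) , p~x
  ... | inj₂ q~x = q , ∈⟦⟧⁺ (there (here refl)) , q~x

  totalDominating-edge : ∀ {T} → TotalDominating G T → Fin n → ∃[ x ] ∃[ y ] (x ∈ T × y ∈ T × y ~ x)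
  totalDominating-edge td v =
    let (x , x∈T , _) = td v ; (y , y∈T , y~x) = td x in x , y , x∈T , y∈T , y~x

  2≤∣totalDominating∣ : ∀ {T} → TotalDominating G T → Fin n → 2 ≤ ∣ T ∣
  2≤∣totalDominating∣ td v =
    let (x , y , x∈T , y∈T , y~x) = totalDominating-edge td v
    in length≤∣∣ ((≢-sym (~⇒≢ y~x) ∷ []) ∷ [] ∷ []) (x∈T ∷ y∈T ∷ [])

  dominatingEdge⇒γt≡2 : ∀ {p q} → NoIsolated G → DominatingEdge G p q → Isγt G 2
  dominatingEdge⇒γt≡2 {p} {q} noIsolated dominating@(p~q , _) =
    noIsolated , ⟦ p ∷ q ∷ [] ⟧ ,
    (dominatingEdge⇒totalDominating dominating ,
     λ T td → subst (_≤ ∣ T ∣) (sym ∣pq∣≡2) (2≤∣totalDominating∣ td p)) ,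
    ∣pq∣≡2
    where
    ∣pq∣≡2 : ∣ ⟦ p ∷ q ∷ [] ⟧ ∣ ≡ 2
    ∣pq∣≡2 = ∣⟦⟧∣ ((~⇒≢ p~q ∷ []) ∷ [] ∷ [])

  ∈-of-three : ∀ {T : Subset n} {x y z t} → ∣ T ∣ ≤ 3 → Unique (x ∷ y ∷ z ∷ []) → All (_∈ T) (x ∷ y ∷ z ∷ []) →
               t ∈ T → t ≡ x ⊎ t ≡ y ⊎ t ≡ z
  ∈-of-three {x = x} {y} {z} {t} ∣T∣≤3 unique xyz∈T t∈T with t ≟ x | t ≟ y | t ≟ z
  ... | yes t≡x | _       | _       = inj₁ t≡x
  ... | no _    | yes t≡y | _       = inj₂ (inj₁ t≡y)
  ... | no _    | no _    | yes t≡z = inj₂ (inj₂ t≡z)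
  ... | no t≢x  | no t≢y  | no t≢z  =
    contradiction (length≤∣∣ ((t≢x ∷ t≢y ∷ t≢z ∷ []) ∷ unique) (t∈T ∷ xyz∈T)) (<⇒≱ (s≤s ∣T∣≤3))

  smallTotalDominating⇒dominatingEdge : ∀ {T} → TotalDominating G T → ∣ T ∣ ≤ 2 → Fin n → HasDominatingEdge G
  smallTotalDominating⇒dominatingEdge {T} td ∣T∣≤2 v with totalDominating-edge td v
  ... | x , y , x∈T , y∈T , y~x = y , x , y~x , dominated
    where
    dominated : ∀ w → y ~ w ⊎ x ~ w
    dominated w with td w
    ... | t , t∈T , t~w with t ≟ y | t ≟ x
    ...   | yes refl | _        = inj₁ t~w
    ...   | no _     | yes refl = inj₂ t~w
    ...   | no t≢y   | no t≢x   =
      contradiction (length≤∣∣ ((t≢y ∷ t≢x ∷ []) ∷ (~⇒≢ y~x ∷ []) ∷ [] ∷ []) (t∈T ∷ y∈T ∷ x∈T ∷ []))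
                    (<⇒≱ (s≤s ∣T∣≤2))

  -- the fifth vertex is one that the edge c z fails to dominate
  5≤n-beyond-path : ∀ {o c z w} → NoDominatingEdge G →
                    o ~ c → c ~ z → z ~ w → ¬ o ~ w → ¬ c ~ w → 5 ≤ n
  5≤n-beyond-path {o} {c} {z} {w} noDominatingEdge o~c c~z z~w o≁w c≁w
    with undominated-vertex (noDominatingEdge c z) c~z
  ... | w′ , c≁w′ , z≁w′ = length≤n {L = w′ ∷ w ∷ z ∷ o ∷ c ∷ []}
    ((w′≢w ∷ w′≢z ∷ w′≢o ∷ w′≢c ∷ []) ∷ (w≢z ∷ w≢o ∷ w≢c ∷ []) ∷ (z≢o ∷ z≢c ∷ []) ∷ (~⇒≢ o~c ∷ []) ∷ [] ∷ [])
    where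
    w′≢w : w′ ≢ w
    w′≢w refl = z≁w′ z~w
    w′≢z : w′ ≢ z
    w′≢z refl = c≁w′ c~z
    w′≢o : w′ ≢ o
    w′≢o refl = c≁w′ (~-sym o~c)
    w′≢c : w′ ≢ c
    w′≢c refl = z≁w′ (~-sym c~z)
    w≢z : w ≢ z
    w≢z refl = ~-irrefl z~w
    w≢o : w ≢ o
    w≢o refl = c≁w (~-sym o~c)
    w≢c : w ≢ c
    w≢c refl = o≁w o~c
    z≢o : z ≢ o
    z≢o refl = o≁w z~w
    z≢c : z ≢ c
    z≢c refl = c≁w z~w

  smallTotalDominating⇒5≤n : ∀ {T} → NoDominatingEdge G → TotalDominating G T → ∣ T ∣ ≤ 3 →
                             Fin n → 5 ≤ n
  smallTotalDominating⇒5≤n {T} noDominatingEdge td ∣T∣≤3 v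
    with totalDominating-edge td v
  ... | x , y , x∈T , y∈T , y~x
    with undominated-vertex (noDominatingEdge y x) y~x
  ... | w , y≁w , x≁w
    with td w
  ... | z , z∈T , z~w
    with td z
  ... | t , t∈T , t~z
    with ∈-of-three ∣T∣≤3 ((~⇒≢ (~-sym y~x) ∷ x≢z ∷ []) ∷ (y≢z ∷ []) ∷ [] ∷ []) (x∈T ∷ y∈T ∷ z∈T ∷ []) t∈T
    where
    x≢z : x ≢ z
    x≢z refl = x≁w z~w
    y≢z : y ≢ z
    y≢z refl = y≁w z~w
  ... | inj₁ refl        = 5≤n-beyond-path noDominatingEdge y~x t~z z~w y≁w x≁w
  ... | inj₂ (inj₁ refl) = 5≤n-beyond-path noDominatingEdge (~-sym y~x) t~z z~w x≁w y≁w
  ... | inj₂ (inj₂ refl) = contradiction t~z ~-irrefl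

-- Total Roman dominating functions

val≢0 : ∀ x → val x ≢ 0 → val x ≡ 1 ⊎ val x ≡ 2
val≢0 0F       0≢0 = contradiction refl 0≢0
val≢0 1F       _   = inj₁ refl
val≢0 2F       _   = inj₂ refl

atLeast : ∀ {m k} → m ≡ k → k ≤ m
atLeast m≡k = ≤-reflexive (sym m≡k)

≡suc⇒≢0 : ∀ {m k} → m ≡ suc k → m ≢ 0
≡suc⇒≢0 refl ()

weight-≥ : ∀ {n} (f : Fin n → Fin 3) {L bs} → Unique L → Pointwise (λ u b → b ≤ val (f u)) L bs → sum bs ≤ weight f
weight-≥ f unique bounds = ≤-trans (sum-≤ bounds) (sumOver≤∑ (val ∘ f) unique)
  where
  sum-≤ : ∀ {L bs} → Pointwise (λ u b → b ≤ val (f u)) L bs → sum bs ≤ sumOver (val ∘ f) L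
  sum-≤ []               = z≤n
  sum-≤ (b≤fu ∷ bounds) = +-mono-≤ b≤fu (sum-≤ bounds)

weight-const1 : ∀ {n} (f : Fin n → Fin 3) → (∀ u → val (f u) ≡ 1) → weight f ≡ n
weight-const1 {n} f ones = trans (∑-cong ones) (∑1≡n n)
  where
  ∑1≡n : ∀ n → ∑ {n} (λ _ → 1) ≡ n
  ∑1≡n zero    = refl
  ∑1≡n (suc n) = cong suc (∑1≡n n)

romanOf : ∀ {n} → Subset n → Subset n → Fin n → Fin 3
romanOf D P u with u ∈ₛ? D | u ∈ₛ? P
... | yes _ | _     = 2F
... | no _  | yes _ = 1F
... | no _  | no _  = 0F

module _ {n} {D P : Subset n} where

  romanOf-∈D : ∀ {u} → u ∈ D → val (romanOf D P u) ≡ 2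
  romanOf-∈D {u} u∈D with u ∈ₛ? D | u ∈ₛ? P
  ... | yes _   | _ = refl
  ... | no u∉D  | _ = contradiction u∈D u∉D

  romanOf-∈P : ∀ {u} → u ∈ P → val (romanOf D P u) ≢ 0
  romanOf-∈P {u} u∈P with u ∈ₛ? D | u ∈ₛ? P
  ... | yes _ | _       = λ ()
  ... | no _  | yes _   = λ ()
  ... | no _  | no u∉P  = contradiction u∈P u∉P

  romanOf-≡0 : ∀ {u} → val (romanOf D P u) ≡ 0 → u ∉ P
  romanOf-≡0 u↦0 u∈P = romanOf-∈P u∈P u↦0

  romanOf-≢0 : D ⊆ P → ∀ {u} → val (romanOf D P u) ≢ 0 → u ∈ P
  romanOf-≢0 D⊆P {u} u↦+ with u ∈ₛ? D | u ∈ₛ? P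
  ... | yes u∈D | _       = D⊆P u∈D
  ... | no _    | yes u∈P = u∈P
  ... | no _    | no _    = contradiction refl u↦+

  romanOf-val : D ⊆ P → ∀ u → val (romanOf D P u) ≡ 𝟙 D u + 𝟙 P u
  romanOf-val D⊆P u with u ∈ₛ? D | u ∈ₛ? P
  ... | yes u∈D | _       rewrite 𝟙-∈ u∈D | 𝟙-∈ (D⊆P u∈D) = refl
  ... | no u∉D  | yes u∈P rewrite 𝟙-∉ D u u∉D | 𝟙-∈ u∈P = refl
  ... | no u∉D  | no u∉P  rewrite 𝟙-∉ D u u∉D | 𝟙-∉ P u u∉P = refl

  romanOf-weight : D ⊆ P → weight (romanOf D P) ≡ ∣ D ∣ + ∣ P ∣
  romanOf-weight D⊆P = begin
    ∑ (λ u → val (romanOf D P u)) ≡⟨ ∑-cong (romanOf-val D⊆P) ⟩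
    ∑ (λ u → 𝟙 D u + 𝟙 P u)       ≡⟨ ∑-+ (𝟙 D) (𝟙 P) ⟩
    ∑ (𝟙 D) + ∑ (𝟙 P)             ≡⟨ sym (cong₂ _+_ (∣∣≡∑𝟙 D) (∣∣≡∑𝟙 P)) ⟩
    ∣ D ∣ + ∣ P ∣                 ∎
    where open ≡-Reasoning

  romanOf-isTRDF : ∀ (G : Graph n) → D ⊆ P →
                   (∀ u → u ∉ P → ∃[ w ] (w ∈ D × w ~[ G ] u)) →
                   (∀ u → u ∈ P → ∃[ w ] (w ∈ P × u ~[ G ] w)) →
                   IsTRDF G (romanOf D P)
  romanOf-isTRDF G D⊆P dominated paired =
    (λ u u↦0 → let (w , w∈D , w~u) = dominated u (romanOf-≡0 u↦0) in w , w~u , romanOf-∈D w∈D) ,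
    (λ u u↦+ → let (w , w∈P , u~w) = paired u (romanOf-≢0 D⊆P u↦+) in w , u~w , romanOf-∈P w∈P)

roman : ∀ {n} → List (Fin n) → List (Fin n) → Fin n → Fin 3
roman twos ones = romanOf ⟦ twos ⟧ ⟦ twos ++ ones ⟧

module _ {n} (twos ones : List (Fin n)) where

  private
    twos⊆all : ⟦ twos ⟧ ⊆ ⟦ twos ++ ones ⟧
    twos⊆all u∈twos = ∈⟦⟧⁺ (∈-++⁺ˡ (∈⟦⟧⁻ u∈twos))

  roman-weight : weight (roman twos ones) ≤ length twos + length (twos ++ ones)
  roman-weight = begin
    weight (roman twos ones)          ≡⟨ romanOf-weight twos⊆all ⟩
    ∣ ⟦ twos ⟧ ∣ + ∣ ⟦ twos ++ ones ⟧ ∣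
      ≤⟨ +-mono-≤ (∣∣≤length twos λ _ → ∈⟦⟧⁻) (∣∣≤length (twos ++ ones) λ _ → ∈⟦⟧⁻) ⟩
    length twos + length (twos ++ ones) ∎
    where open ≤-Reasoning

  roman-isTRDF : ∀ (G : Graph n) →
                 (∀ u → u ∉ₗ twos ++ ones → ∃[ w ] (w ∈ₗ twos × w ~[ G ] u)) →
                 (∀ u → u ∈ₗ twos ++ ones → ∃[ w ] (w ∈ₗ twos ++ ones × u ~[ G ] w)) →
                 IsTRDF G (roman twos ones)
  roman-isTRDF G dominated paired = romanOf-isTRDF G twos⊆all
    (λ u u∉ → let (w , w∈ , w~u) = dominated u (u∉ ∘ ∈⟦⟧⁺) in w , ∈⟦⟧⁺ w∈ , w~u)
    (λ u u∈ → let (w , w∈ , u~w) = paired u (∈⟦⟧⁻ u∈) in w , ∈⟦⟧⁺ w∈ , u~w)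

any-function? : ∀ {k} n (P : (Fin n → Fin k) → Set) → (∀ {f g} → (∀ u → f u ≡ g u) → P f → P g) →
                (∀ f → Dec (P f)) → Dec (∃ P)
any-function? zero P resp P? with P? (λ ())
... | yes Pf = yes (_ , Pf)
... | no ¬Pf = no λ (f , Pf) → ¬Pf (resp (λ ()) Pf)
any-function? (suc n) P resp P?
  with any-function? n (λ g → ∃[ a ] P (a Vector.∷ g))
         (λ g≗h (a , Pag) → a , resp (λ { zero → refl ; (suc u) → g≗h u }) Pag)
         (λ g → any? λ a → P? (a Vector.∷ g))
... | yes (g , a , Pag) = yes (a Vector.∷ g , Pag)
... | no none           = no λ (f , Pf) → none (f ∘ suc , f zero , resp (λ { zero → refl ; (suc u) → refl }) Pf)

module _ {n} (G : Graph n) where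
  open Adjacency G

  isTRDF? : ∀ f → Dec (IsTRDF G f)
  isTRDF? f =
    all? (λ v → (val (f v) ≟ℕ 0) →-dec any? (λ u → (u ~? v) ×-dec (val (f u) ≟ℕ 2)))
    ×-dec
    all? (λ v → ¬? (val (f v) ≟ℕ 0) →-dec any? (λ u → (v ~? u) ×-dec ¬? (val (f u) ≟ℕ 0)))

  isTRDF-resp : ∀ {f g} → (∀ u → f u ≡ g u) → IsTRDF G f → IsTRDF G g
  isTRDF-resp f≗g (dominated , paired) =
    (λ v v↦0 → let (u , u~v , u↦2) = dominated v (trans (cong val (f≗g v)) v↦0)
               in u , u~v , trans (cong val (sym (f≗g u))) u↦2) ,
    (λ v v↦+ → let (u , v~u , u↦+) = paired v (v↦+ ∘ trans (cong val (sym (f≗g v))))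
               in u , v~u , u↦+ ∘ trans (cong val (f≗g u)))

  γtR≤weight : ∀ {f} → NoIsolated G → IsTRDF G f → ∃[ k ] (IsγtR G k × k ≤ weight f)
  γtR≤weight noIsolated = descend (<-wellFounded _)
    where
    descend : ∀ {f} → Acc _<_ (weight f) → IsTRDF G f → ∃[ k ] (IsγtR G k × k ≤ weight f)
    descend {f} (acc lighter) trdf
      with any-function? n (λ g → IsTRDF G g × weight g < weight f)
             (λ f≗g (trdf′ , lt) → isTRDF-resp f≗g trdf′ , subst (_< weight f) (∑-cong (cong val ∘ f≗g)) lt)
             (λ g → isTRDF? g ×-dec (weight g <? weight f))
    ... | yes (g , trdf′ , g<f) =
      let (k , γtR≡k , k≤g) = descend (lighter g<f) trdf′ in k , γtR≡k , ≤-trans k≤g (<⇒≤ g<f)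
    ... | no none = weight f , (noIsolated , f , trdf , refl , λ g trdf′ → ≮⇒≥ λ g<f → none (g , trdf′ , g<f)) , ≤-refl

module _ {n} (G : Graph n) where
  open Adjacency G

  dominatingEdge⇒lightTRDF : ∀ {p q} → DominatingEdge G p q → ∃[ f ] (IsTRDF G f × weight f ≤ 4)
  dominatingEdge⇒lightTRDF {p} {q} (p~q , dominated) =
    roman (p ∷ q ∷ []) [] , roman-isTRDF _ _ G zeros positives , roman-weight (p ∷ q ∷ []) []
    where
    zeros : ∀ u → u ∉ₗ p ∷ q ∷ [] → ∃[ w ] (w ∈ₗ p ∷ q ∷ [] × w ~ u)
    zeros u _ with dominated u
    ... | inj₁ p~u = p , here refl , p~u
    ... | inj₂ q~u = q , there (here refl) , q~u
    positives : ∀ u → u ∈ₗ p ∷ q ∷ [] → ∃[ w ] (w ∈ₗ p ∷ q ∷ [] × u ~ w)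
    positives u (here refl)         = q , there (here refl) , p~q
    positives u (there (here refl)) = p , here refl , ~-sym p~q

  dominatingEdge⇒γtR≤4 : ∀ {p q} → NoIsolated G → DominatingEdge G p q → ∃[ k ] (IsγtR G k × k ≤ 4)
  dominatingEdge⇒γtR≤4 noIsolated dominating =
    let (f , trdf , f≤4) = dominatingEdge⇒lightTRDF dominating
        (k , γtR≡k , k≤f) = γtR≤weight G noIsolated trdf
    in k , γtR≡k , ≤-trans k≤f f≤4

  universal⇒lightTRDF : ∀ {v a} → Universal G v → v ~ a → ∃[ f ] (IsTRDF G f × weight f ≤ 3)
  universal⇒lightTRDF {v} {a} universal v~a =
    roman (v ∷ []) (a ∷ []) , roman-isTRDF _ _ G zeros positives , roman-weight (v ∷ []) (a ∷ [])
    where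
    zeros : ∀ u → u ∉ₗ v ∷ a ∷ [] → ∃[ w ] (w ∈ₗ v ∷ [] × w ~ u)
    zeros u u∉ = v , here refl , universal u (u∉ ∘ here)
    positives : ∀ u → u ∈ₗ v ∷ a ∷ [] → ∃[ w ] (w ∈ₗ v ∷ a ∷ [] × u ~ w)
    positives u (here refl)         = a , there (here refl) , v~a
    positives u (there (here refl)) = v , here refl , ~-sym v~a

  const1-isTRDF : NoIsolated G → IsTRDF G (const 1F)
  const1-isTRDF noIsolated = (λ _ ()) , λ v _ → let (u , v~u) = noIsolated v in u , v~u , λ ()

  no2⇒const1 : ∀ {f} → IsTRDF G f → ¬ (∃[ v ] (val (f v) ≡ 2)) → ∀ v → val (f v) ≡ 1
  no2⇒const1 {f} (dominated , _) no2 v with val (f v) ≟ℕ 0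
  ... | yes v↦0 = let (u , _ , u↦2) = dominated v v↦0 in contradiction (u , u↦2) no2
  ... | no v↦+ with val≢0 (f v) v↦+
  ...   | inj₁ v↦1 = v↦1
  ...   | inj₂ v↦2 = contradiction (v , v↦2) no2

  -- a vertex valued 2 and its positive partner dominate every vertex, or the weight exceeds 4
  lightTRDF⇒dominatingEdge : ∀ {f} → IsTRDF G f → weight f ≤ 4 → HasDominatingEdge G ⊎ n ≤ 4
  lightTRDF⇒dominatingEdge {f} trdf@(dominated , paired) w with any? (λ v → val (f v) ≟ℕ 2)
  ... | no no2 = inj₂ (subst (_≤ 4) (weight-const1 f (no2⇒const1 trdf no2)) w)
  ... | yes (v , v↦2) with paired v (≡suc⇒≢0 v↦2)
  ... | a , v~a , a↦+ = inj₁ (v , a , v~a , dominates)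
    where
    dominates : ∀ x → v ~ x ⊎ a ~ x
    dominates x with x ≟ v | x ≟ a
    ... | yes refl | _        = inj₂ (~-sym v~a)
    ... | no _     | yes refl = inj₁ v~a
    ... | no x≢v   | no x≢a with val (f x) ≟ℕ 0
    ...   | yes x↦0 with dominated x x↦0
    ...     | u , u~x , u↦2 with u ≟ v | u ≟ a
    ...       | yes refl | _        = inj₁ u~x
    ...       | no _     | yes refl = inj₂ u~x
    ...       | no u≢v   | no u≢a   = contradiction
      (weight-≥ f {L = v ∷ a ∷ u ∷ []} ((~⇒≢ v~a ∷ ≢-sym u≢v ∷ []) ∷ (≢-sym u≢a ∷ []) ∷ [] ∷ [])
                  (atLeast v↦2 ∷ n≢0⇒n>0 a↦+ ∷ atLeast u↦2 ∷ []))
      (<⇒≱ (s≤s w))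
    dominates x | no x≢v | no x≢a | no x↦+ with paired x x↦+
    ...   | u , x~u , u↦+ with u ≟ v | u ≟ a
    ...     | yes refl | _        = inj₁ (~-sym x~u)
    ...     | no _     | yes refl = inj₂ (~-sym x~u)
    ...     | no u≢v   | no u≢a   = contradiction
      (weight-≥ f {L = v ∷ a ∷ x ∷ u ∷ []}
                  ((~⇒≢ v~a ∷ ≢-sym x≢v ∷ ≢-sym u≢v ∷ []) ∷ (≢-sym x≢a ∷ ≢-sym u≢a ∷ []) ∷ (~⇒≢ x~u ∷ []) ∷ [] ∷ [])
                  (atLeast v↦2 ∷ n≢0⇒n>0 a↦+ ∷ n≢0⇒n>0 x↦+ ∷ n≢0⇒n>0 u↦+ ∷ []))
      (<⇒≱ (s≤s w))

  noDominatingEdge⇒heavy : NoDominatingEdge G → 5 ≤ n → ∀ f → IsTRDF G f → 5 ≤ weight f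
  noDominatingEdge⇒heavy noDominatingEdge 5≤n f trdf with 5 ≤? weight f
  ... | yes 5≤f = 5≤f
  ... | no 5≰f with lightTRDF⇒dominatingEdge trdf (≤-pred (≰⇒> 5≰f))
  ...   | inj₁ (p , q , dominating) = contradiction dominating (noDominatingEdge p q)
  ...   | inj₂ n≤4                  = contradiction 5≤n (<⇒≱ (s≤s n≤4))

-- Isolated edges and K₂ ∪ Kₘ

IsolatedEdge : ∀ {n} → Graph n → Fin n → Fin n → Set
IsolatedEdge G b c = b ~[ G ] c × (∀ u → b ~[ G ] u → u ≡ c) × (∀ u → c ~[ G ] u → u ≡ b)

module _ {n} (G : Graph n) where
  open Adjacency G

  isolatedEdge-apart : ∀ {b c x} → IsolatedEdge G b c → x ≢ b → x ≢ c → ¬ (b ~ x ⊎ c ~ x)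
  isolatedEdge-apart (_ , N[b] , N[c]) x≢b x≢c (inj₁ b~x) = x≢c (N[b] _ b~x)
  isolatedEdge-apart (_ , N[b] , N[c]) x≢b x≢c (inj₂ c~x) = x≢b (N[c] _ c~x)

  -- to dominate both b and c a dominating edge must be c b, which misses x
  isolatedEdge⇒noDominatingEdge : ∀ {b c x} → IsolatedEdge G b c → x ≢ b → x ≢ c → NoDominatingEdge G
  isolatedEdge⇒noDominatingEdge {b} {c} {x} isolated@(b~c , N[b] , N[c]) x≢b x≢c p q (_ , dominated)
    with dominated b | dominated c
  ... | inj₁ p~b | inj₁ p~c = ~⇒≢ b~c (trans (sym (N[c] p (~-sym p~c))) (N[b] p (~-sym p~b)))
  ... | inj₂ q~b | inj₂ q~c = ~⇒≢ b~c (trans (sym (N[c] q (~-sym q~c))) (N[b] q (~-sym q~b)))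
  ... | inj₁ p~b | inj₂ q~c with N[b] p (~-sym p~b) | N[c] q (~-sym q~c)
  ...   | refl | refl = isolatedEdge-apart isolated x≢b x≢c (Data.Sum.swap (dominated x))
  isolatedEdge⇒noDominatingEdge isolated@(_ , N[b] , N[c]) x≢b x≢c p q (_ , dominated)
      | inj₂ q~b | inj₁ p~c with N[b] q (~-sym q~b) | N[c] p (~-sym p~c)
  ...   | refl | refl = isolatedEdge-apart isolated x≢b x≢c (dominated _)

K2∪K-Adj≡true : ∀ m {x y : Fin (2 + m)} → K2∪K-Adj m x y ≡ true ⇔ (x ≢ y × side {m} x ≡ side {m} y)
K2∪K-Adj≡true m {x} {y} with x ≟ y | side {m} x | side {m} y
... | yes x≡y | _     | _     = mk⇔ (λ ()) (λ (x≢y , _) → contradiction x≡y x≢y)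
... | no x≢y  | true  | true  = mk⇔ (λ _ → x≢y , refl) (λ _ → refl)
... | no x≢y  | false | false = mk⇔ (λ _ → x≢y , refl) (λ _ → refl)
... | no _    | true  | false = mk⇔ (λ ()) (λ ())
... | no _    | false | true  = mk⇔ (λ ()) (λ ())

↔-injective : ∀ {n m} (φ : Fin n ↔ Fin m) {i j} → Inverse.to φ i ≡ Inverse.to φ j → i ≡ j
↔-injective φ eq = trans (sym (inverseˡ φ)) (trans (cong (Inverse.from φ) eq) (inverseˡ φ))

module _ {n m} (G : Graph n) (φ : Fin n ↔ Fin (2 + m)) where
  open Adjacency G
  open Inverse φ using (to; from)

  SameSideAdjacency : Set
  SameSideAdjacency = ∀ {i j} → i ~ j ⇔ (i ≢ j × side {m} (to i) ≡ side {m} (to j))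

  IsK2∪K-adjacency : (∀ i j → Adj G i j ≡ K2∪K-Adj m (to i) (to j)) → SameSideAdjacency
  IsK2∪K-adjacency iso {i} {j} = mk⇔
    (λ i~j → let (φi≢φj , same) = Equivalence.to (K2∪K-Adj≡true m) (trans (sym (iso i j)) i~j)
             in (φi≢φj ∘ cong to) , same)
    (λ (i≢j , same) → trans (iso i j) (Equivalence.from (K2∪K-Adj≡true m) ((i≢j ∘ ↔-injective φ) , same)))

  adjacency-IsK2∪K : SameSideAdjacency → ∀ i j → Adj G i j ≡ K2∪K-Adj m (to i) (to j)
  adjacency-IsK2∪K adjacency i j = ⇔→≡ (mk⇔
    (λ i~j → let (i≢j , same) = Equivalence.to adjacency i~j
             in Equivalence.from (K2∪K-Adj≡true m) ((i≢j ∘ ↔-injective φ) , same))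
    (λ k → let (φi≢φj , same) = Equivalence.to (K2∪K-Adj≡true m) k
           in Equivalence.from adjacency ((φi≢φj ∘ cong to) , same)))

two-valued : ∀ {a b : Bool} → a ≢ b → ∀ c → c ≡ a ⊎ c ≡ b
two-valued {true}  {true}  a≢b _     = contradiction refl a≢b
two-valued {false} {false} a≢b _     = contradiction refl a≢b
two-valued {true}  {false} _   true  = inj₁ refl
two-valued {true}  {false} _   false = inj₂ refl
two-valued {false} {true}  _   true  = inj₂ refl
two-valued {false} {true}  _   false = inj₁ refl

module K2∪Kₘ {n k} (G : Graph n) (φ : Fin n ↔ Fin (2 + (3 + k))) (adjacency : SameSideAdjacency G φ) where
  open Adjacency G
  open Inverse φ using (to; from)

  sideOf : Fin n → Bool
  sideOf i = side {3 + k} (to i)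

  same⇒~ : ∀ {i j} → i ≢ j → sideOf i ≡ sideOf j → i ~ j
  same⇒~ i≢j same = Equivalence.from adjacency (i≢j , same)

  ~⇒same : ∀ {i j} → i ~ j → sideOf i ≡ sideOf j
  ~⇒same i~j = proj₂ (Equivalence.to adjacency i~j)

  p₀ p₁ q₀ q₁ q₂ : Fin n
  p₀ = from 0F
  p₁ = from 1F
  q₀ = from 2F
  q₁ = from (suc 2F)
  q₂ = from (suc (suc 2F))

  from-apart : ∀ {x y} → x ≢ y → from x ≢ from y
  from-apart x≢y eq = x≢y (trans (sym (inverseʳ φ)) (trans (cong to eq) (inverseʳ φ)))

  sideOf-from : ∀ x → sideOf (from x) ≡ side {3 + k} x
  sideOf-from x = cong side (inverseʳ φ)

  distinct₄ : Unique (p₀ ∷ p₁ ∷ q₀ ∷ q₁ ∷ [])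
  distinct₄ = (from-apart (λ ()) ∷ from-apart (λ ()) ∷ from-apart (λ ()) ∷ [])
            ∷ (from-apart (λ ()) ∷ from-apart (λ ()) ∷ [])
            ∷ (from-apart (λ ()) ∷ [])
            ∷ [] ∷ []

  5≤n : 5 ≤ n
  5≤n = length≤n {L = q₂ ∷ p₀ ∷ p₁ ∷ q₀ ∷ q₁ ∷ []}
    ((from-apart (λ ()) ∷ from-apart (λ ()) ∷ from-apart (λ ()) ∷ from-apart (λ ()) ∷ []) ∷ distinct₄)

  sideOf≡true : ∀ {u} → sideOf u ≡ true → u ≡ p₀ ⊎ u ≡ p₁
  sideOf≡true {u} side≡true with to u in eq
  ... | 0F = inj₁ (trans (sym (inverseˡ φ)) (cong from eq))
  ... | 1F = inj₂ (trans (sym (inverseˡ φ)) (cong from eq))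

  adjacent-to-one : ∀ {a b u} → a ≢ b → sideOf a ≡ sideOf b → sideOf u ≡ sideOf a →
                    ∃[ w ] (w ∈ₗ a ∷ b ∷ [] × u ~ w)
  adjacent-to-one {a} {b} {u} a≢b same sameᵤ with u ≟ a
  ... | yes refl = b , there (here refl) , same⇒~ a≢b same
  ... | no u≢a   = a , here refl , same⇒~ u≢a sameᵤ

  adjacent-to-p : ∀ u → sideOf u ≡ true → ∃[ w ] (w ∈ₗ p₀ ∷ p₁ ∷ [] × u ~ w)
  adjacent-to-p u side≡true = adjacent-to-one (from-apart λ ()) (trans (sideOf-from 0F) (sym (sideOf-from 1F)))
                                              (trans side≡true (sym (sideOf-from 0F)))

  adjacent-to-q : ∀ u → sideOf u ≡ false → ∃[ w ] (w ∈ₗ q₀ ∷ q₁ ∷ [] × u ~ w)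
  adjacent-to-q u side≡false = adjacent-to-one (from-apart λ ()) (trans (sideOf-from 2F) (sym (sideOf-from (suc 2F))))
                                               (trans side≡false (sym (sideOf-from 2F)))

  noIsolated : NoIsolated G
  noIsolated u with sideOf u in side-u
  ... | true  = let (w , _ , u~w) = adjacent-to-p u side-u in w , u~w
  ... | false = let (w , _ , u~w) = adjacent-to-q u side-u in w , u~w

  isolated : IsolatedEdge G p₀ p₁
  isolated = same⇒~ p₀≢p₁ (trans (sideOf-from 0F) (sym (sideOf-from 1F))) , N[p₀] , N[p₁]
    where
    p₀≢p₁ : p₀ ≢ p₁
    p₀≢p₁ = from-apart λ ()
    N[p₀] : ∀ u → p₀ ~ u → u ≡ p₁
    N[p₀] u p₀~u with sideOf≡true (trans (sym (~⇒same p₀~u)) (sideOf-from 0F))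
    ... | inj₁ refl  = contradiction p₀~u ~-irrefl
    ... | inj₂ u≡p₁ = u≡p₁
    N[p₁] : ∀ u → p₁ ~ u → u ≡ p₀
    N[p₁] u p₁~u with sideOf≡true (trans (sym (~⇒same p₁~u)) (sideOf-from 1F))
    ... | inj₁ u≡p₀ = u≡p₀
    ... | inj₂ refl  = contradiction p₁~u ~-irrefl

  q₀~q₁ : q₀ ~ q₁
  q₀~q₁ = same⇒~ (from-apart λ ()) (trans (sideOf-from 2F) (sym (sideOf-from (suc 2F))))

  noDominatingEdge : NoDominatingEdge G
  noDominatingEdge = isolatedEdge⇒noDominatingEdge G {x = q₀} isolated (from-apart λ ()) (from-apart λ ())

  heavy : ∀ f → IsTRDF G f → 5 ≤ weight f
  heavy = noDominatingEdge⇒heavy G noDominatingEdge 5≤n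

  γtR≡5 : IsγtR G 5
  γtR≡5 = noIsolated , f , trdf , ≤-antisym (roman-weight (q₀ ∷ []) (p₀ ∷ p₁ ∷ q₁ ∷ [])) (heavy f trdf) , heavy
    where
    f = roman (q₀ ∷ []) (p₀ ∷ p₁ ∷ q₁ ∷ [])
    zeros : ∀ u → u ∉ₗ q₀ ∷ p₀ ∷ p₁ ∷ q₁ ∷ [] → ∃[ w ] (w ∈ₗ q₀ ∷ [] × w ~ u)
    zeros u u∉ with sideOf u in side-u
    ... | true with sideOf≡true side-u
    ...   | inj₁ refl = contradiction (there (here refl)) u∉
    ...   | inj₂ refl = contradiction (there (there (here refl))) u∉
    zeros u u∉ | false = q₀ , here refl , same⇒~ (λ { refl → u∉ (here refl) }) (trans (sideOf-from 2F) (sym side-u))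
    positives : ∀ u → u ∈ₗ q₀ ∷ p₀ ∷ p₁ ∷ q₁ ∷ [] → ∃[ w ] (w ∈ₗ q₀ ∷ p₀ ∷ p₁ ∷ q₁ ∷ [] × u ~ w)
    positives u (here refl)                         = q₁ , there (there (there (here refl))) , q₀~q₁
    positives u (there (here refl))                 = p₁ , there (there (here refl)) , proj₁ isolated
    positives u (there (there (here refl)))         = p₀ , there (here refl) , ~-sym (proj₁ isolated)
    positives u (there (there (there (here refl)))) = q₀ , here refl , ~-sym q₀~q₁
    trdf : IsTRDF G f
    trdf = roman-isTRDF _ _ G zeros positives

  nonEdge : NonEdge G
  nonEdge = ≁⇒nonEdge (from-apart λ ()) λ p₀~q₀ →
    contradiction (trans (sym (sideOf-from 0F)) (trans (~⇒same p₀~q₀) (sideOf-from 2F))) λ ()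

  cross-edge⇒dominatingEdge : ∀ (H : Graph n) {u v} → (∀ {x y} → x ~ y → x ~[ H ] y) → u ~[ H ] v →
                              sideOf u ≢ sideOf v → DominatingEdge H u v
  cross-edge⇒dominatingEdge H {u} {v} G⊆H u~v sides-differ = u~v , dominated
    where
    dominated : ∀ w → u ~[ H ] w ⊎ v ~[ H ] w
    dominated w with w ≟ u | w ≟ v | two-valued sides-differ (sideOf w)
    ... | yes refl | _        | _          = inj₂ (Adjacency.~-sym H u~v)
    ... | no _     | yes refl | _          = inj₁ u~v
    ... | no w≢u   | no _     | inj₁ same = inj₁ (G⊆H (same⇒~ (≢-sym w≢u) (sym same)))
    ... | no _     | no w≢v   | inj₂ same = inj₂ (G⊆H (same⇒~ (≢-sym w≢v) (sym same)))

  crossing : ∀ e → DominatingEdge (addEdge G e) (proj₁ e) (proj₁ (proj₂ e))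
  crossing e@(u , v , u≢v , u≁v) = cross-edge⇒dominatingEdge (addEdge G e) (addEdge-⊇ G e) (addEdge-new G e) λ same →
    contradiction (trans (sym (same⇒~ u≢v same)) u≁v) λ ()

  trCritical : TRCritical 5 G
  trCritical = noIsolated , γtR≡5 , nonEdge , λ e →
    let (k , γtR≡k , k≤4) = dominatingEdge⇒γtR≤4 (addEdge G e) (addEdge-noIsolated G e noIsolated) (crossing e)
    in k , γtR≡k , s≤s k≤4

  T₄ : Subset n
  T₄ = ⟦ p₀ ∷ p₁ ∷ q₀ ∷ q₁ ∷ [] ⟧

  T₄-totalDominating : TotalDominating G T₄
  T₄-totalDominating u with sideOf u in side-u
  ... | true  = let (w , w∈ , u~w) = adjacent-to-p u side-u in w , ∈⟦⟧⁺ (∈-++⁺ˡ w∈) , ~-sym u~w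
  ... | false = let (w , w∈ , u~w) = adjacent-to-q u side-u in w , ∈⟦⟧⁺ (∈-++⁺ʳ (p₀ ∷ p₁ ∷ []) w∈) , ~-sym u~w

  4≤∣totalDominating∣ : ∀ {T} → TotalDominating G T → 4 ≤ ∣ T ∣
  4≤∣totalDominating∣ td with td p₀ | td q₀
  ... | a , a∈T , a~p₀ | c , c∈T , c~q₀ with td a | td c
  ... | b , b∈T , b~a | d , d∈T , d~c =
    length≤∣∣ {L = a ∷ b ∷ c ∷ d ∷ []}
      ((~⇒≢ (~-sym b~a) ∷ apart side-a side-c ∷ apart side-a side-d ∷ [])
       ∷ (apart side-b side-c ∷ apart side-b side-d ∷ []) ∷ (~⇒≢ (~-sym d~c) ∷ []) ∷ [] ∷ [])
      (a∈T ∷ b∈T ∷ c∈T ∷ d∈T ∷ [])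
    where
    apart : ∀ {x y} → sideOf x ≡ true → sideOf y ≡ false → x ≢ y
    apart side-x side-y refl = contradiction (trans (sym side-x) side-y) λ ()
    side-a = trans (~⇒same a~p₀) (sideOf-from 0F)
    side-b = trans (~⇒same b~a) side-a
    side-c = trans (~⇒same c~q₀) (sideOf-from 2F)
    side-d = trans (~⇒same d~c) side-c

  γt≡4 : Isγt G 4
  γt≡4 = noIsolated , T₄ , (T₄-totalDominating , λ T td → subst (_≤ ∣ T ∣) (sym ∣T₄∣) (4≤∣totalDominating∣ td)) , ∣T₄∣
    where
    ∣T₄∣ : ∣ T₄ ∣ ≡ 4
    ∣T₄∣ = ∣⟦⟧∣ distinct₄

  tSupercritical : TSupercritical 4 G
  tSupercritical = noIsolated , γt≡4 , nonEdge , λ e →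
    dominatingEdge⇒γt≡2 (addEdge G e) (addEdge-noIsolated G e noIsolated) (crossing e)

K2∪K⇒trCritical : ∀ {n} (G : Graph n) m → 3 ≤ m → IsK2∪K G m → TRCritical 5 G
K2∪K⇒trCritical G (suc (suc (suc k))) (s≤s (s≤s (s≤s _))) (φ , iso) = K2∪Kₘ.trCritical G φ (IsK2∪K-adjacency G φ iso)

K2∪K⇒tSupercritical : ∀ {n} (G : Graph n) m → 3 ≤ m → IsK2∪K G m → TSupercritical 4 G
K2∪K⇒tSupercritical G (suc (suc (suc k))) (s≤s (s≤s (s≤s _))) (φ , iso) =
  K2∪Kₘ.tSupercritical G φ (IsK2∪K-adjacency G φ iso)

transpose-matchˡ : ∀ {n} (i j : Fin n) → transpose i j ⟨$⟩ʳ i ≡ j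
transpose-matchˡ i j rewrite dec-true (i ≟ i) refl = refl

transpose-other : ∀ {n} {i j k : Fin n} → k ≢ i → k ≢ j → transpose i j ⟨$⟩ʳ k ≡ k
transpose-other {i = i} {j} {k} k≢i k≢j rewrite dec-false (k ≟ i) k≢i | dec-false (k ≟ j) k≢j = refl

to-front : ∀ {m} {b c : Fin (2 + m)} → b ≢ c → ∃[ φ ] (Inverse.to φ b ≡ 0F × Inverse.to φ c ≡ 1F)
to-front {b = b} {c} b≢c = π ∘ₚ ρ , trans (cong (ρ ⟨$⟩ʳ_) (transpose-matchˡ b 0F)) (transpose-other (c′≢0 ∘ sym) λ ()) ,
                                     transpose-matchˡ c′ 1F
  where
  π = transpose b 0F
  c′ = π ⟨$⟩ʳ c
  ρ = transpose c′ 1F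
  c′≢0 : c′ ≢ 0F
  c′≢0 c′≡0 = b≢c (↔-injective π (trans (transpose-matchˡ b 0F) (sym c′≡0)))

module _ {n} (G : Graph n) where
  open Adjacency G

  isolatedEdge+clique⇒K2∪K : ∀ {b c} → 5 ≤ n → IsolatedEdge G b c →
                             (∀ {x y} → x ≢ y → x ≢ b → x ≢ c → y ≢ b → y ≢ c → x ~ y) →
                             ∃[ m ] (3 ≤ m × IsK2∪K G m)
  isolatedEdge+clique⇒K2∪K {b} {c} (s≤s (s≤s 3≤m)) isolated@(b~c , N[b] , N[c]) clique
    with to-front (~⇒≢ b~c)
  ... | φ , φb≡0 , φc≡1 = _ , 3≤m , φ , adjacency-IsK2∪K G φ sameSide
    where
    open Inverse φ using (to)
    Inside : Fin n → Set
    Inside i = i ≡ b ⊎ i ≡ c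
    inside? : ∀ i → Inside i ⊎ (i ≢ b × i ≢ c)
    inside? i with i ≟ b | i ≟ c
    ... | yes i≡b | _       = inj₁ (inj₁ i≡b)
    ... | no _    | yes i≡c = inj₁ (inj₂ i≡c)
    ... | no i≢b  | no i≢c  = inj₂ (i≢b , i≢c)
    side-inside : ∀ {i} → Inside i → side (to i) ≡ true
    side-inside (inj₁ refl) = cong side φb≡0
    side-inside (inj₂ refl) = cong side φc≡1
    side-outside : ∀ {i} → i ≢ b → i ≢ c → side (to i) ≡ false
    side-outside {i} i≢b i≢c with to i in φi
    ... | 0F          = contradiction (↔-injective φ (trans φi (sym φb≡0))) i≢b
    ... | 1F          = contradiction (↔-injective φ (trans φi (sym φc≡1))) i≢c
    ... | suc (suc _) = refl
    inside-adjacent : ∀ {i j} → Inside i → Inside j → i ≢ j → i ~ j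
    inside-adjacent (inj₁ refl) (inj₁ refl) i≢j = contradiction refl i≢j
    inside-adjacent (inj₁ refl) (inj₂ refl) _   = b~c
    inside-adjacent (inj₂ refl) (inj₁ refl) _   = ~-sym b~c
    inside-adjacent (inj₂ refl) (inj₂ refl) i≢j = contradiction refl i≢j
    inside-edge : ∀ {i j} → Inside i → i ~ j → b ~ j ⊎ c ~ j
    inside-edge (inj₁ refl) i~j = inj₁ i~j
    inside-edge (inj₂ refl) i~j = inj₂ i~j
    sameSide : SameSideAdjacency G φ
    sameSide {i} {j} with inside? i | inside? j
    ... | inj₁ i-in | inj₁ j-in = mk⇔ (λ i~j → ~⇒≢ i~j , trans (side-inside i-in) (sym (side-inside j-in)))
                                      (λ (i≢j , _) → inside-adjacent i-in j-in i≢j)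
    ... | inj₂ (i≢b , i≢c) | inj₂ (j≢b , j≢c) =
      mk⇔ (λ i~j → ~⇒≢ i~j , trans (side-outside i≢b i≢c) (sym (side-outside j≢b j≢c)))
          (λ (i≢j , _) → clique i≢j i≢b i≢c j≢b j≢c)
    ... | inj₁ i-in | inj₂ (j≢b , j≢c) =
      mk⇔ (λ i~j → ⊥-elim (isolatedEdge-apart G isolated j≢b j≢c (inside-edge i-in i~j)))
          (λ (_ , same) → contradiction (trans (sym (side-inside i-in)) (trans same (side-outside j≢b j≢c))) λ ())
    ... | inj₂ (i≢b , i≢c) | inj₁ j-in =
      mk⇔ (λ i~j → ⊥-elim (isolatedEdge-apart G isolated i≢b i≢c (inside-edge j-in (~-sym i~j))))
          (λ (_ , same) → contradiction (trans (sym (side-outside i≢b i≢c)) (trans same (side-inside j-in))) λ ())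

-- Nested minimum dominating sets

module _ {n} (G : Graph n) where
  open Adjacency G

  nestedMinima⇒trCritical : TCritical 3 G →
                            ∃[ S ] ∃[ T ] (MinDominating G S × MinTotalDominating G T × S ⊂ T) →
                            TRCritical 5 G
  nestedMinima⇒trCritical (noIsolated , (_ , T₀ , (td₀ , T₀-min) , ∣T₀∣≡3) , nonEdge , critical)
                          (S , T , (S-dominating , _) , (T-td , T-min) , S⊂T) =
    noIsolated , γtR≡5 , nonEdge , criticality
    where
    3≤∣totalDominating∣ : ∀ {T′} → TotalDominating G T′ → 3 ≤ ∣ T′ ∣
    3≤∣totalDominating∣ td = subst (_≤ _) ∣T₀∣≡3 (T₀-min _ td)
    ∣T∣≡3 : ∣ T ∣ ≡ 3
    ∣T∣≡3 = ≤-antisym (subst (∣ T ∣ ≤_) ∣T₀∣≡3 (T-min T₀ td₀)) (3≤∣totalDominating∣ T-td)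
    ∣S∣≤2 : ∣ S ∣ ≤ 2
    ∣S∣≤2 = ≤-pred (subst (∣ S ∣ <_) ∣T∣≡3 (p⊂q⇒∣p∣<∣q∣ S⊂T))
    noDominatingEdge : NoDominatingEdge G
    noDominatingEdge p q dominating = contradiction
      (3≤∣totalDominating∣ (dominatingEdge⇒totalDominating G dominating))
      (<⇒≱ (s≤s (∣∣≤length (p ∷ q ∷ []) λ _ → ∈⟦⟧⁻)))
    heavy : ∀ f → IsTRDF G f → 5 ≤ weight f
    heavy = noDominatingEdge⇒heavy G noDominatingEdge
      (smallTotalDominating⇒5≤n G noDominatingEdge T-td (≤-reflexive ∣T∣≡3) (proj₁ nonEdge))
    S⊆T = p⊂q⇒p⊆q S⊂T
    trdf : IsTRDF G (romanOf S T)
    trdf = romanOf-isTRDF G S⊆T (λ u u∉T → S-dominating u (u∉T ∘ S⊆T))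
                                (λ u _ → let (w , w∈T , w~u) = T-td u in w , w∈T , ~-sym w~u)
    γtR≡5 : IsγtR G 5
    γtR≡5 = noIsolated , romanOf S T , trdf ,
            ≤-antisym (subst (_≤ 5) (sym (romanOf-weight S⊆T)) (+-mono-≤ ∣S∣≤2 (≤-reflexive ∣T∣≡3)))
                      (heavy _ trdf) ,
            heavy
    criticality : ∀ e → ∃[ k ] (IsγtR (addEdge G e) k × k < 5)
    criticality e with critical e
    ... | k , (_ , T′ , (td′ , _) , ∣T′∣≡k) , k<3
      with smallTotalDominating⇒dominatingEdge (addEdge G e) td′ (≤-pred (subst (_< 3) (sym ∣T′∣≡k) k<3)) (proj₁ e)
    ... | p , q , dominating =
      let (k′ , γtR≡k′ , k′≤4) = dominatingEdge⇒γtR≤4 (addEdge G e) (addEdge-noIsolated G e noIsolated) dominating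
      in k′ , γtR≡k′ , s≤s k′≤4

record NestedDomination {n} (G : Graph n) (x y z : Fin n) : Set where
  field
    x≢y : x ≢ y
    x≢z : x ≢ z
    y≢z : y ≢ z
    pair-dominates : ∀ u → u ≢ x → u ≢ y → x ~[ G ] u ⊎ y ~[ G ] u
    x-covered : y ~[ G ] x ⊎ z ~[ G ] x
    y-covered : x ~[ G ] y ⊎ z ~[ G ] y

module Heavy {n} (G : Graph n) (noIsolated : NoIsolated G) (heavy : ∀ f → IsTRDF G f → 5 ≤ weight f) where
  open Adjacency G

  noDominatingEdge : NoDominatingEdge G
  noDominatingEdge p q dominating =
    let (f , trdf , f≤4) = dominatingEdge⇒lightTRDF G dominating in <⇒≱ (s≤s f≤4) (heavy f trdf)

  noUniversal : ∀ v → ¬ Universal G v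
  noUniversal v universal =
    let (f , trdf , f≤3) = universal⇒lightTRDF G universal (proj₂ (noIsolated v))
    in <⇒≱ (s≤s (m≤n⇒m≤1+n f≤3)) (heavy f trdf)

  noNearlyUniversal : ∀ {v b} → b ≢ v → ¬ v ~ b → ¬ (∀ u → u ≢ v → u ≢ b → v ~ u)
  noNearlyUniversal {v} {b} b≢v v≁b nearlyUniversal with noIsolated b
  ... | w , b~w = <⇒≱ (s≤s (roman-weight (v ∷ []) (w ∷ b ∷ []))) (heavy _ (roman-isTRDF _ _ G zeros positives))
    where
    w≢v : w ≢ v
    w≢v refl = v≁b (~-sym b~w)
    v~w : v ~ w
    v~w = nearlyUniversal w w≢v (≢-sym (~⇒≢ b~w))
    zeros : ∀ u → u ∉ₗ v ∷ w ∷ b ∷ [] → ∃[ x ] (x ∈ₗ v ∷ [] × x ~ u)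
    zeros u u∉ = v , here refl , nearlyUniversal u (u∉ ∘ here) (u∉ ∘ there ∘ there ∘ here)
    positives : ∀ u → u ∈ₗ v ∷ w ∷ b ∷ [] → ∃[ x ] (x ∈ₗ v ∷ w ∷ b ∷ [] × u ~ x)
    positives u (here refl)                 = w , there (here refl) , v~w
    positives u (there (here refl))         = v , here refl , ~-sym v~w
    positives u (there (there (here refl))) = w , there (here refl) , b~w

  5≤n : 5 ≤ n
  5≤n = subst (5 ≤_) (weight-const1 (const 1F) λ _ → refl) (heavy _ (const1-isTRDF G noIsolated))

  2≤∣dominating∣ : ∀ {S} → Dominating G S → Fin n → 2 ≤ ∣ S ∣
  2≤∣dominating∣ {S} dominating x with member
    where
    member : ∃[ u ] u ∈ S
    member with x ∈ₛ? S
    ... | yes x∈S = x , x∈S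
    ... | no x∉S  = let (u , u∈S , _) = dominating x x∉S in u , u∈S
  ... | u , u∈S with any? (λ w → (w ∈ₛ? S) ×-dec ¬? (w ≟ u))
  ...   | yes (w , w∈S , w≢u) = length≤∣∣ ((≢-sym w≢u ∷ []) ∷ [] ∷ []) (u∈S ∷ w∈S ∷ [])
  ...   | no none = contradiction universal (noUniversal u)
    where
    universal : Universal G u
    universal t t≢u with t ∈ₛ? S
    ... | yes t∈S = contradiction (t , t∈S , t≢u) none
    ... | no t∉S with dominating t t∉S
    ...   | w , w∈S , w~t with w ≟ u
    ...     | yes refl = w~t
    ...     | no w≢u   = contradiction (w , w∈S , w≢u) none

  addedEdge-dominates : (∀ e → ∃[ k ] (IsγtR (addEdge G e) k × k < 5)) → ∀ e → HasDominatingEdge (addEdge G e)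
  addedEdge-dominates critical e with critical e
  ... | k , (_ , f , trdf , f≡k , _) , k<5
    with lightTRDF⇒dominatingEdge (addEdge G e) trdf (≤-pred (subst (_< 5) (sym f≡k) k<5))
  ... | inj₁ dominating = dominating
  ... | inj₂ n≤4        = contradiction 5≤n (<⇒≱ (s≤s n≤4))

  3≤∣totalDominating∣ : ∀ {T} → TotalDominating G T → Fin n → 3 ≤ ∣ T ∣
  3≤∣totalDominating∣ {T} td v with 3 ≤? ∣ T ∣
  ... | yes 3≤T = 3≤T
  ... | no 3≰T  = let (p , q , dominating) = smallTotalDominating⇒dominatingEdge G td (≤-pred (≰⇒> 3≰T)) v
                  in contradiction dominating (noDominatingEdge p q)

  nestedDomination⇒nestedMinima : NonEdge G → (∀ e → HasDominatingEdge (addEdge G e)) →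
                                  ∀ {x y z} → NestedDomination G x y z →
                                  TCritical 3 G × ∃[ S ] ∃[ T ] (MinDominating G S × MinTotalDominating G T × S ⊂ T)
  nestedDomination⇒nestedMinima nonEdge dominates {x} {y} {z} nested =
    (noIsolated , (noIsolated , T , T-min , ∣T∣≡3) , nonEdge , criticality) , S , T , S-min , T-min , S⊂T
    where
    open NestedDomination nested
    S T : Subset n
    S = ⟦ x ∷ y ∷ [] ⟧
    T = ⟦ x ∷ y ∷ z ∷ [] ⟧
    ∣S∣≡2 : ∣ S ∣ ≡ 2
    ∣S∣≡2 = ∣⟦⟧∣ ((x≢y ∷ []) ∷ [] ∷ [])
    ∣T∣≡3 : ∣ T ∣ ≡ 3
    ∣T∣≡3 = ∣⟦⟧∣ ((x≢y ∷ x≢z ∷ []) ∷ (y≢z ∷ []) ∷ [] ∷ [])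
    S-dominating : Dominating G S
    S-dominating u u∉S with pair-dominates u (u∉S ∘ ∈⟦⟧⁺ ∘ here) (u∉S ∘ ∈⟦⟧⁺ ∘ there ∘ here)
    ... | inj₁ x~u = x , ∈⟦⟧⁺ (here refl) , x~u
    ... | inj₂ y~u = y , ∈⟦⟧⁺ (there (here refl)) , y~u
    S-min : MinDominating G S
    S-min = S-dominating , λ S′ dominating → subst (_≤ ∣ S′ ∣) (sym ∣S∣≡2) (2≤∣dominating∣ dominating x)
    T-totalDominating : TotalDominating G T
    T-totalDominating u with u ≟ x | u ≟ y
    T-totalDominating u | yes refl | _ with x-covered
    ... | inj₁ y~x = y , ∈⟦⟧⁺ (there (here refl)) , y~x
    ... | inj₂ z~x = z , ∈⟦⟧⁺ (there (there (here refl))) , z~x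
    T-totalDominating u | no _ | yes refl with y-covered
    ... | inj₁ x~y = x , ∈⟦⟧⁺ (here refl) , x~y
    ... | inj₂ z~y = z , ∈⟦⟧⁺ (there (there (here refl))) , z~y
    T-totalDominating u | no u≢x | no u≢y with pair-dominates u u≢x u≢y
    ... | inj₁ x~u = x , ∈⟦⟧⁺ (here refl) , x~u
    ... | inj₂ y~u = y , ∈⟦⟧⁺ (there (here refl)) , y~u
    T-min : MinTotalDominating G T
    T-min = T-totalDominating , λ T′ td → subst (_≤ ∣ T′ ∣) (sym ∣T∣≡3) (3≤∣totalDominating∣ td x)
    S⊂T : S ⊂ T
    S⊂T = (λ u∈S → ∈⟦⟧⁺ (∈-++⁺ˡ (∈⟦⟧⁻ u∈S))) , z , ∈⟦⟧⁺ (there (there (here refl))) , λ z∈S → z∉xy (∈⟦⟧⁻ z∈S)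
      where
      z∉xy : z ∉ₗ x ∷ y ∷ []
      z∉xy (here z≡x)         = x≢z (sym z≡x)
      z∉xy (there (here z≡y)) = y≢z (sym z≡y)
    criticality : ∀ e → ∃[ k ] (Isγt (addEdge G e) k × k < 3)
    criticality e = let (_ , _ , dominating) = dominates e in
      2 , dominatingEdge⇒γt≡2 (addEdge G e) (addEdge-noIsolated G e noIsolated) dominating , ≤-refl

  isolatedEdge-clique : (∀ e → HasDominatingEdge (addEdge G e)) → ∀ {b c} → IsolatedEdge G b c →
                        ∀ {x y} → x ≢ y → x ≢ b → x ≢ c → y ≢ b → y ≢ c → x ~ y
  isolatedEdge-clique dominates {b} {c} (b~c , N[b] , N[c]) {x} {y} x≢y x≢b x≢c y≢b y≢c with x ~? y
  ... | yes x~y = x~y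
  ... | no x≁y with dominates (≁⇒nonEdge x≢y x≁y)
  ...   | p , q , dominating = contradiction dominating (isolatedEdge⇒noDominatingEdge H isolatedᴴ x≢b x≢c p q)
    where
    e = ≁⇒nonEdge x≢y x≁y
    H = addEdge G e
    isolatedᴴ : IsolatedEdge H b c
    isolatedᴴ = addEdge-⊇ G e b~c ,
                (λ u b~u → N[b] u (addEdge-old G e (≢-sym x≢b) (≢-sym y≢b) b~u)) ,
                (λ u c~u → N[c] u (addEdge-old G e (≢-sym x≢c) (≢-sym y≢c) c~u))

-- TRDFs of weight 5 taking the value 2

Structure : ∀ {n} → Graph n → Set
Structure G = (∃[ x ] ∃[ y ] ∃[ z ] NestedDomination G x y z) ⊎ (∃[ b ] ∃[ c ] IsolatedEdge G b c)

module LightTRDF {n} (G : Graph n) (noDominatingEdge : NoDominatingEdge G)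
                 {f : Fin n → Fin 3} (trdf : IsTRDF G f) (light : weight f ≤ 5) where
  open Adjacency G

  Positive : Fin n → Set
  Positive u = val (f u) ≢ 0

  Support : List (Fin n) → Set
  Support L = ∀ u → Positive u → u ∈ₗ L

  dominated-by-2 : ∀ u → val (f u) ≡ 0 → ∃[ w ] (w ~ u × val (f w) ≡ 2)
  dominated-by-2 = proj₁ trdf

  partner : ∀ u → Positive u → ∃[ w ] (u ~ w × Positive w)
  partner = proj₂ trdf

  support-by-weight : ∀ {L bs} → Unique L → Pointwise (λ u b → b ≤ val (f u)) L bs → weight f ≤ sum bs → Support L
  support-by-weight {L} unique bounds full u u↦+ = decidable-stable (u ∈ₗ? L) λ u∉L →
    contradiction (weight-≥ f (¬Any⇒All¬ L u∉L ∷ unique) (n≢0⇒n>0 u↦+ ∷ bounds)) (<⇒≱ (s≤s full))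

  search : ∀ {L} → Unique L → Support L ⊎ ∃[ u ] (Unique (u ∷ L) × Positive u)
  search {L} unique with any? (λ u → ¬? (u ∈ₗ? L) ×-dec ¬? (val (f u) ≟ℕ 0))
  ... | yes (u , u∉L , u↦+) = inj₂ (u , ¬Any⇒All¬ L u∉L ∷ unique , u↦+)
  ... | no none             = inj₁ (λ u u↦+ → decidable-stable (u ∈ₗ? L) λ u∉L → none (u , u∉L , u↦+))

  ↦-apart : ∀ {x y k l} → val (f x) ≡ k → val (f y) ≡ l → k ≢ l → x ≢ y
  ↦-apart x↦k y↦l k≢l refl = k≢l (trans (sym x↦k) y↦l)

  dominatingPair : ∀ {v a} → v ~ a → (∀ u → val (f u) ≡ 2 → u ≡ v ⊎ u ≡ a) →
                   (∀ u → Positive u → u ≢ v → u ≢ a → v ~ u ⊎ a ~ u) → DominatingEdge G v a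
  dominatingPair {v} {a} v~a twos others = v~a , dominates
    where
    dominates : ∀ x → v ~ x ⊎ a ~ x
    dominates x with x ≟ v | x ≟ a
    ... | yes refl | _        = inj₂ (~-sym v~a)
    ... | no _     | yes refl = inj₁ v~a
    ... | no x≢v   | no x≢a with val (f x) ≟ℕ 0
    ...   | no x↦+  = others x x↦+ x≢v x≢a
    ...   | yes x↦0 with dominated-by-2 x x↦0
    ...     | w , w~x , w↦2 with twos w w↦2
    ...       | inj₁ refl = inj₁ w~x
    ...       | inj₂ refl = inj₂ w~x

  edge-and-one : ∀ {b v a} → v ~ a → Support (b ∷ v ∷ a ∷ []) → val (f b) ≡ 1 → ⊥
  edge-and-one {b} {v} {a} v~a supp b↦1 = noDominatingEdge v a (dominatingPair v~a twos others)
    where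
    twos : ∀ u → val (f u) ≡ 2 → u ≡ v ⊎ u ≡ a
    twos u u↦2 with supp u (≡suc⇒≢0 u↦2)
    ... | here refl                 = contradiction (trans (sym b↦1) u↦2) λ ()
    ... | there (here u≡v)          = inj₁ u≡v
    ... | there (there (here u≡a))  = inj₂ u≡a
    others : ∀ u → Positive u → u ≢ v → u ≢ a → v ~ u ⊎ a ~ u
    others u u↦+ u≢v u≢a with supp u u↦+
    ... | there (here u≡v)         = contradiction u≡v u≢v
    ... | there (there (here u≡a)) = contradiction u≡a u≢a
    ... | here refl with partner u u↦+
    ...   | w , u~w , w↦+ with supp w w↦+
    ...     | here refl                 = contradiction u~w ~-irrefl
    ...     | there (here refl)         = inj₁ (~-sym u~w)
    ...     | there (there (here refl)) = inj₂ (~-sym u~w)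

  module Star {v a} (v~a : v ~ a) (v↦2 : val (f v) ≡ 2) (a↦1 : val (f a) ≡ 1) where

    module _ {b c} (supp : Support (b ∷ c ∷ v ∷ a ∷ [])) (b↦1 : val (f b) ≡ 1) (c↦1 : val (f c) ≡ 1) where

      only-v-is-2 : ∀ {u} → val (f u) ≡ 2 → u ≡ v
      only-v-is-2 {u} u↦2 with supp u (≡suc⇒≢0 u↦2)
      ... | here refl                        = contradiction (trans (sym b↦1) u↦2) λ ()
      ... | there (here refl)                = contradiction (trans (sym c↦1) u↦2) λ ()
      ... | there (there (here u≡v))         = u≡v
      ... | there (there (there (here refl))) = contradiction (trans (sym a↦1) u↦2) λ ()

      zero⇒v~ : ∀ {u} → val (f u) ≡ 0 → v ~ u
      zero⇒v~ u↦0 with dominated-by-2 _ u↦0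
      ... | w , w~u , w↦2 with only-v-is-2 w↦2
      ...   | refl = w~u

      pair-dominates : b ~ c → ∀ u → u ≢ v → u ≢ b → v ~ u ⊎ b ~ u
      pair-dominates b~c u u≢v u≢b with val (f u) ≟ℕ 0
      ... | yes u↦0 = inj₁ (zero⇒v~ u↦0)
      ... | no u↦+ with supp u u↦+
      ...   | here u≡b                        = contradiction u≡b u≢b
      ...   | there (here refl)               = inj₂ b~c
      ...   | there (there (here u≡v))        = contradiction u≡v u≢v
      ...   | there (there (there (here refl))) = inj₁ v~a

    swap-support : ∀ {b c} → Support (b ∷ c ∷ v ∷ a ∷ []) → Support (c ∷ b ∷ v ∷ a ∷ [])
    swap-support supp u u↦+ with supp u u↦+
    ... | here u≡b          = there (here u≡b)
    ... | there (here u≡c)  = here u≡c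
    ... | there (there u∈) = there (there u∈)

    -- β is not dominated by {v, a}, so its positive partner is γ
    module SplitOff {β γ} (β≢v : β ≢ v) (γ≢v : γ ≢ v) (γ≢a : γ ≢ a) (supp : Support (β ∷ γ ∷ v ∷ a ∷ []))
                    (β↦1 : val (f β) ≡ 1) (γ↦1 : val (f γ) ≡ 1) (β-alone : ¬ (v ~ β ⊎ a ~ β)) where

      β~γ : β ~ γ
      β~γ with partner β (≡suc⇒≢0 β↦1)
      ... | w , β~w , w↦+ with supp w w↦+
      ...   | here refl                         = contradiction β~w ~-irrefl
      ...   | there (here refl)                 = β~w
      ...   | there (there (here refl))         = ⊥-elim (β-alone (inj₁ (~-sym β~w)))
      ...   | there (there (there (here refl))) = ⊥-elim (β-alone (inj₂ (~-sym β~w)))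

      β-dominates : ∀ u → u ≢ v → u ≢ β → v ~ u ⊎ β ~ u
      β-dominates = pair-dominates supp β↦1 γ↦1 β~γ

      γ-dominates : ∀ u → u ≢ v → u ≢ γ → v ~ u ⊎ γ ~ u
      γ-dominates = pair-dominates (swap-support supp) γ↦1 β↦1 (~-sym β~γ)

      nested-with-zero : ∀ {y z} → y ≢ v → val (f y) ≡ 1 → (∀ u → u ≢ v → u ≢ y → v ~ u ⊎ y ~ u) →
                         val (f z) ≡ 0 → z ~ y → NestedDomination G v y z
      nested-with-zero y≢v y↦1 dominates z↦0 z~y = record
        { x≢y = ≢-sym y≢v ; x≢z = ↦-apart v↦2 z↦0 (λ ()) ; y≢z = ↦-apart y↦1 z↦0 (λ ())
        ; pair-dominates = dominates
        ; x-covered = inj₂ (~-sym (zero⇒v~ supp β↦1 γ↦1 z↦0))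
        ; y-covered = inj₂ z~y
        }

      structure : Structure G
      structure with v ~? γ | a ~? γ | any? (λ z → (val (f z) ≟ℕ 0) ×-dec (z ~? β))
                                     | any? (λ z → (val (f z) ≟ℕ 0) ×-dec (z ~? γ))
      ... | yes v~γ | _       | _                    | _ = inj₁ (v , β , γ , record
        { x≢y = ≢-sym β≢v ; x≢z = ≢-sym γ≢v ; y≢z = ~⇒≢ β~γ
        ; pair-dominates = β-dominates ; x-covered = inj₂ (~-sym v~γ) ; y-covered = inj₂ (~-sym β~γ) })
      ... | no _    | yes a~γ | _                    | _ = inj₁ (v , γ , a , record
        { x≢y = ≢-sym γ≢v ; x≢z = ~⇒≢ v~a ; y≢z = γ≢a
        ; pair-dominates = γ-dominates ; x-covered = inj₂ (~-sym v~a) ; y-covered = inj₂ a~γ })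
      ... | no _    | no _    | yes (z , z↦0 , z~β) | _ = inj₁ (v , β , z , nested-with-zero β≢v β↦1 β-dominates z↦0 z~β)
      ... | no _    | no _    | no _ | yes (z , z↦0 , z~γ) = inj₁ (v , γ , z , nested-with-zero γ≢v γ↦1 γ-dominates z↦0 z~γ)
      ... | no v≁γ  | no a≁γ  | no no-zero~β | no no-zero~γ = inj₂ (β , γ , β~γ , N[β] , N[γ])
        where
        N[β] : ∀ u → β ~ u → u ≡ γ
        N[β] u β~u with val (f u) ≟ℕ 0
        ... | yes u↦0 = contradiction (u , u↦0 , ~-sym β~u) no-zero~β
        ... | no u↦+ with supp u u↦+
        ...   | here refl                         = contradiction β~u ~-irrefl
        ...   | there (here u≡γ)                  = u≡γ
        ...   | there (there (here refl))         = ⊥-elim (β-alone (inj₁ (~-sym β~u)))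
        ...   | there (there (there (here refl))) = ⊥-elim (β-alone (inj₂ (~-sym β~u)))
        N[γ] : ∀ u → γ ~ u → u ≡ β
        N[γ] u γ~u with val (f u) ≟ℕ 0
        ... | yes u↦0 = contradiction (u , u↦0 , ~-sym γ~u) no-zero~γ
        ... | no u↦+ with supp u u↦+
        ...   | here u≡β                          = u≡β
        ...   | there (here refl)                 = contradiction γ~u ~-irrefl
        ...   | there (there (here refl))         = contradiction (~-sym γ~u) v≁γ
        ...   | there (there (there (here refl))) = contradiction (~-sym γ~u) a≁γ

    threeOnes : ∀ {c b} → Unique (c ∷ b ∷ v ∷ a ∷ []) → Support (c ∷ b ∷ v ∷ a ∷ []) →
                val (f b) ≡ 1 → val (f c) ≡ 1 → Structure G
    threeOnes {c} {b} ((_ ∷ c≢v ∷ c≢a ∷ []) ∷ (b≢v ∷ b≢a ∷ []) ∷ _) supp b↦1 c↦1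
      with (v ~? b) ⊎-dec (a ~? b) | (v ~? c) ⊎-dec (a ~? c)
    ... | _          | no c-alone = SplitOff.structure c≢v b≢v b≢a supp c↦1 b↦1 c-alone
    ... | no b-alone | yes _      = SplitOff.structure b≢v c≢v c≢a (swap-support supp) b↦1 c↦1 b-alone
    ... | yes b-dominated | yes c-dominated = ⊥-elim (noDominatingEdge v a (dominatingPair v~a twos others))
      where
      twos : ∀ u → val (f u) ≡ 2 → u ≡ v ⊎ u ≡ a
      twos u u↦2 = inj₁ (only-v-is-2 supp c↦1 b↦1 u↦2)
      others : ∀ u → Positive u → u ≢ v → u ≢ a → v ~ u ⊎ a ~ u
      others u u↦+ u≢v u≢a with supp u u↦+
      ... | here refl                        = c-dominated
      ... | there (here refl)                = b-dominated
      ... | there (there (here u≡v))         = contradiction u≡v u≢v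
      ... | there (there (there (here u≡a))) = contradiction u≡a u≢a

  two-twos : ∀ {b v a} → Unique (b ∷ v ∷ a ∷ []) → v ~ a → Support (b ∷ v ∷ a ∷ []) →
             val (f b) ≡ 2 → val (f a) ≡ 1 → NestedDomination G v b a
  two-twos {b} {v} {a} ((b≢v ∷ b≢a ∷ []) ∷ _) v~a supp b↦2 a↦1 = record
    { x≢y = ≢-sym b≢v ; x≢z = ~⇒≢ v~a ; y≢z = b≢a
    ; pair-dominates = dominates ; x-covered = inj₂ (~-sym v~a) ; y-covered = b-covered }
    where
    dominates : ∀ u → u ≢ v → u ≢ b → v ~ u ⊎ b ~ u
    dominates u u≢v u≢b with val (f u) ≟ℕ 0
    ... | no u↦+ with supp u u↦+
    ...   | here u≡b                  = contradiction u≡b u≢b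
    ...   | there (here u≡v)          = contradiction u≡v u≢v
    ...   | there (there (here refl)) = inj₁ v~a
    dominates u u≢v u≢b | yes u↦0 with dominated-by-2 u u↦0
    ... | w , w~u , w↦2 with supp w (≡suc⇒≢0 w↦2)
    ...   | here refl                 = inj₂ w~u
    ...   | there (here refl)         = inj₁ w~u
    ...   | there (there (here refl)) = contradiction (trans (sym a↦1) w↦2) λ ()
    b-covered : v ~ b ⊎ a ~ b
    b-covered with partner b (≡suc⇒≢0 b↦2)
    ... | w , b~w , w↦+ with supp w w↦+
    ...   | here refl                 = contradiction b~w ~-irrefl
    ...   | there (here refl)         = inj₁ (~-sym b~w)
    ...   | there (there (here refl)) = inj₂ (~-sym b~w)

  structure : ∀ v → val (f v) ≡ 2 → Structure G
  structure v v↦2 with partner v (≡suc⇒≢0 v↦2)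
  ... | a , v~a , a↦+ with search ((~⇒≢ v~a ∷ []) ∷ [] ∷ [])
  ...   | inj₁ supp = ⊥-elim (noDominatingEdge v a (dominatingPair v~a twos others))
    where
    twos : ∀ u → val (f u) ≡ 2 → u ≡ v ⊎ u ≡ a
    twos u u↦2 with supp u (≡suc⇒≢0 u↦2)
    ... | here u≡v         = inj₁ u≡v
    ... | there (here u≡a) = inj₂ u≡a
    others : ∀ u → Positive u → u ≢ v → u ≢ a → v ~ u ⊎ a ~ u
    others u u↦+ u≢v u≢a with supp u u↦+
    ... | here u≡v         = contradiction u≡v u≢v
    ... | there (here u≡a) = contradiction u≡a u≢a
  ...   | inj₂ (b , unique₃ , b↦+) with val≢0 (f a) a↦+ | val≢0 (f b) b↦+
  ...     | inj₂ a↦2 | inj₂ b↦2 =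
    contradiction (weight-≥ f unique₃ (atLeast b↦2 ∷ atLeast v↦2 ∷ atLeast a↦2 ∷ [])) (<⇒≱ (s≤s light))
  ...     | inj₂ a↦2 | inj₁ b↦1 =
    ⊥-elim (edge-and-one v~a (support-by-weight unique₃ (atLeast b↦1 ∷ atLeast v↦2 ∷ atLeast a↦2 ∷ []) light) b↦1)
  ...     | inj₁ a↦1 | inj₂ b↦2 = inj₁ (v , b , a ,
    two-twos unique₃ v~a (support-by-weight unique₃ (atLeast b↦2 ∷ atLeast v↦2 ∷ atLeast a↦1 ∷ []) light) b↦2 a↦1)
  ...     | inj₁ a↦1 | inj₁ b↦1 with search unique₃
  ...       | inj₁ supp = ⊥-elim (edge-and-one v~a supp b↦1)
  ...       | inj₂ (c , unique₄ , c↦+) with val≢0 (f c) c↦+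
  ...         | inj₂ c↦2 =
    contradiction (weight-≥ f unique₄ (atLeast c↦2 ∷ atLeast b↦1 ∷ atLeast v↦2 ∷ atLeast a↦1 ∷ [])) (<⇒≱ (s≤s light))
  ...         | inj₁ c↦1 = Star.threeOnes v~a v↦2 a↦1 unique₄
    (support-by-weight unique₄ (atLeast c↦1 ∷ atLeast b↦1 ∷ atLeast v↦2 ∷ atLeast a↦1 ∷ []) light) b↦1 c↦1

-- Five vertices

module _ {n} (G : Graph n) (noIsolated : NoIsolated G) where
  open Adjacency G

  MaxDegree≤1 : Set
  MaxDegree≤1 = ∀ {v a a′} → v ~ a → v ~ a′ → a ≡ a′

  Closed : List (Fin n) → Set
  Closed L = ∀ {x y} → x ∈ₗ L → x ~ y → y ∈ₗ L

  -- with maximum degree 1 the edges form a perfect matching, grown two vertices at a time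
  matching-extend : MaxDegree≤1 → ∀ {L} → Closed L → Unique L → length L < n →
                    ∃[ L′ ] (Closed L′ × Unique L′ × length L′ ≡ 2 + length L)
  matching-extend degree≤1 {L} closed unique L<n with fresh L L<n
  ... | t , t∉L with noIsolated t
  ...   | u , t~u = u ∷ t ∷ L , closed′ , (~⇒≢ (~-sym t~u) ∷ ¬Any⇒All¬ L u∉L) ∷ ¬Any⇒All¬ L t∉L ∷ unique , refl
    where
    u∉L : u ∉ₗ L
    u∉L u∈L = t∉L (closed u∈L (~-sym t~u))
    closed′ : Closed (u ∷ t ∷ L)
    closed′ (here refl)         u~y = there (here (degree≤1 u~y (~-sym t~u)))
    closed′ (there (here refl)) t~y = here (degree≤1 t~y t~u)
    closed′ (there (there x∈L)) x~y = there (there (closed x∈L x~y))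

  matching-grow : MaxDegree≤1 → ∀ k → 2 * k ≤ n → ∃[ L ] (Closed L × Unique L × length L ≡ 2 * k)
  matching-grow degree≤1 zero    _        = [] , (λ ()) , [] , refl
  matching-grow degree≤1 (suc k) 2+2k≤n
    with matching-grow degree≤1 k (≤-trans (*-monoʳ-≤ 2 (n≤1+n k)) 2+2k≤n)
  ... | L , closed , unique , L≡2k
    with matching-extend degree≤1 closed unique (subst (_< n) (sym L≡2k) (≤-trans (n≤1+n _) (subst (_≤ n) (*-suc 2 k) 2+2k≤n)))
  ... | L′ , closed′ , unique′ , L′≡2+L =
    L′ , closed′ , unique′ , trans L′≡2+L (trans (cong (2 +_) L≡2k) (sym (*-suc 2 k)))

  even-order : MaxDegree≤1 → ∀ k → n ≢ suc (2 * k)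
  even-order degree≤1 k refl with matching-grow degree≤1 k (n≤1+n _)
  ... | L , closed , unique , L≡2k with matching-extend degree≤1 closed unique (subst (_< suc (2 * k)) (sym L≡2k) ≤-refl)
  ...   | L′ , _ , unique′ , L′≡2+L =
    <⇒≱ (subst (suc (2 * k) <_) (sym (trans L′≡2+L (cong (2 +_) L≡2k))) ≤-refl) (length≤n unique′)

  n≡5⇒degree-2-vertex : n ≡ 5 → ∃[ v ] ∃[ a ] ∃[ a′ ] (a ≢ a′ × v ~ a × v ~ a′)
  n≡5⇒degree-2-vertex n≡5 with any? (λ v → any? (λ a → any? (λ a′ → ¬? (a ≟ a′) ×-dec (v ~? a) ×-dec (v ~? a′))))
  ... | yes found = found
  ... | no none   = contradiction n≡5 (even-order degree≤1 2)
    where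
    degree≤1 : MaxDegree≤1
    degree≤1 {v} {a} {a′} v~a v~a′ = decidable-stable (a ≟ a′) λ a≢a′ → none (v , a , a′ , a≢a′ , v~a , v~a′)

-- for n = 5 a minimum TRDF may be constantly 1; a minimum one taking the value 2 is built by hand
module FiveVertices {n} (G : Graph n) (noIsolated : NoIsolated G) (heavy : ∀ f → IsTRDF G f → 5 ≤ weight f)
                    (n≡5 : n ≡ 5) where
  open Adjacency G
  open Heavy G noIsolated heavy using (noUniversal; noNearlyUniversal)

  HeavyVertexTRDF : Set
  HeavyVertexTRDF = ∃[ f ] (IsTRDF G f × weight f ≤ 5 × ∃[ v ] (val (f v) ≡ 2))

  roman-heavyVertex : ∀ v twos ones → IsTRDF G (roman (v ∷ twos) ones) → weight (roman (v ∷ twos) ones) ≤ 5 → HeavyVertexTRDF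
  roman-heavyVertex v twos ones trdf light = roman (v ∷ twos) ones , trdf , light , v , romanOf-∈D (∈⟦⟧⁺ (here refl))

  star : ∀ {v x x′ b c} → v ~ x → v ~ x′ → (∀ u → u ≢ v → u ≢ x → u ≢ b → u ≢ c → u ≡ x′) →
         b ~ x ⊎ b ~ c → c ~ x ⊎ c ~ b → HeavyVertexTRDF
  star {v} {x} {x′} {b} {c} v~x v~x′ only-x′ b-partner c-partner =
    roman-heavyVertex v [] (x ∷ b ∷ c ∷ []) (roman-isTRDF _ _ G zeros positives) (roman-weight (v ∷ []) (x ∷ b ∷ c ∷ []))
    where
    zeros : ∀ u → u ∉ₗ v ∷ x ∷ b ∷ c ∷ [] → ∃[ w ] (w ∈ₗ v ∷ [] × w ~ u)
    zeros u u∉ with only-x′ u (u∉ ∘ here) (u∉ ∘ there ∘ here) (u∉ ∘ there ∘ there ∘ here)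
                              (u∉ ∘ there ∘ there ∘ there ∘ here)
    ... | refl = v , here refl , v~x′
    positives : ∀ u → u ∈ₗ v ∷ x ∷ b ∷ c ∷ [] → ∃[ w ] (w ∈ₗ v ∷ x ∷ b ∷ c ∷ [] × u ~ w)
    positives u (here refl)         = x , there (here refl) , v~x
    positives u (there (here refl)) = v , here refl , ~-sym v~x
    positives u (there (there (here refl))) =
      [ (λ b~x → x , there (here refl) , b~x) , (λ b~c → c , there (there (there (here refl))) , b~c) ]′ b-partner
    positives u (there (there (there (here refl)))) =
      [ (λ c~x → x , there (here refl) , c~x) , (λ c~b → b , there (there (here refl)) , c~b) ]′ c-partner

  cross : ∀ {v x x′ b c} → v ~ x → v ~ x′ → (∀ u → u ≢ x → u ≢ x′ → u ≢ v → u ≡ b ⊎ u ≡ c) →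
          b ~ x → c ~ x′ → HeavyVertexTRDF
  cross {v} {x} {x′} {b} {c} v~x v~x′ only-bc b~x c~x′ =
    roman-heavyVertex x (x′ ∷ []) (v ∷ []) (roman-isTRDF _ _ G zeros positives) (roman-weight (x ∷ x′ ∷ []) (v ∷ []))
    where
    zeros : ∀ u → u ∉ₗ x ∷ x′ ∷ v ∷ [] → ∃[ w ] (w ∈ₗ x ∷ x′ ∷ [] × w ~ u)
    zeros u u∉ with only-bc u (u∉ ∘ here) (u∉ ∘ there ∘ here) (u∉ ∘ there ∘ there ∘ here)
    ... | inj₁ refl = x , here refl , ~-sym b~x
    ... | inj₂ refl = x′ , there (here refl) , ~-sym c~x′
    positives : ∀ u → u ∈ₗ x ∷ x′ ∷ v ∷ [] → ∃[ w ] (w ∈ₗ x ∷ x′ ∷ v ∷ [] × u ~ w)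
    positives u (here refl)                 = v , there (there (here refl)) , ~-sym v~x
    positives u (there (here refl))         = v , there (there (here refl)) , ~-sym v~x′
    positives u (there (there (here refl))) = x , here refl , v~x

  module Spread {v a a′ b c} (a≢a′ : a ≢ a′) (v~a : v ~ a) (v~a′ : v ~ a′) (b≢v : b ≢ v) (v≁b : ¬ v ~ b)
                (c≢v : c ≢ v) (c≢b : c ≢ b) (v≁c : ¬ v ~ c) where

    non-neighbours-apart : ∀ {x y} → v ~ x → ¬ v ~ y → x ≢ y
    non-neighbours-apart v~x v≁y refl = v≁y v~x

    everything : ∀ u → u ∈ₗ v ∷ a ∷ a′ ∷ b ∷ c ∷ []
    everything = covered
      ((~⇒≢ v~a ∷ ~⇒≢ v~a′ ∷ ≢-sym b≢v ∷ ≢-sym c≢v ∷ [])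
       ∷ (a≢a′ ∷ non-neighbours-apart v~a v≁b ∷ non-neighbours-apart v~a v≁c ∷ [])
       ∷ (non-neighbours-apart v~a′ v≁b ∷ non-neighbours-apart v~a′ v≁c ∷ [])
       ∷ (≢-sym c≢b ∷ []) ∷ [] ∷ [])
      (≤-reflexive n≡5)

    neighbour-of-b : b ~ a ⊎ b ~ a′ ⊎ b ~ c
    neighbour-of-b with noIsolated b
    ... | w , b~w with everything w
    ...   | here refl                                 = contradiction (~-sym b~w) v≁b
    ...   | there (here refl)                         = inj₁ b~w
    ...   | there (there (here refl))                 = inj₂ (inj₁ b~w)
    ...   | there (there (there (here refl)))         = contradiction b~w ~-irrefl
    ...   | there (there (there (there (here refl)))) = inj₂ (inj₂ b~w)

    neighbour-of-c : c ~ a ⊎ c ~ a′ ⊎ c ~ b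
    neighbour-of-c with noIsolated c
    ... | w , c~w with everything w
    ...   | here refl                                 = contradiction (~-sym c~w) v≁c
    ...   | there (here refl)                         = inj₁ c~w
    ...   | there (there (here refl))                 = inj₂ (inj₁ c~w)
    ...   | there (there (there (here refl)))         = inj₂ (inj₂ c~w)
    ...   | there (there (there (there (here refl)))) = contradiction c~w ~-irrefl

    only-a′ : ∀ u → u ≢ v → u ≢ a → u ≢ b → u ≢ c → u ≡ a′
    only-a′ u u≢v u≢a u≢b u≢c with everything u
    ... | here u≡v                                 = contradiction u≡v u≢v
    ... | there (here u≡a)                         = contradiction u≡a u≢a
    ... | there (there (here u≡a′))                = u≡a′
    ... | there (there (there (here u≡b)))         = contradiction u≡b u≢b
    ... | there (there (there (there (here u≡c)))) = contradiction u≡c u≢c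

    only-a : ∀ u → u ≢ v → u ≢ a′ → u ≢ b → u ≢ c → u ≡ a
    only-a u u≢v u≢a′ u≢b u≢c with everything u
    ... | here u≡v                                 = contradiction u≡v u≢v
    ... | there (here u≡a)                         = u≡a
    ... | there (there (here u≡a′))                = contradiction u≡a′ u≢a′
    ... | there (there (there (here u≡b)))         = contradiction u≡b u≢b
    ... | there (there (there (there (here u≡c)))) = contradiction u≡c u≢c

    only-bc : ∀ u → u ≢ a → u ≢ a′ → u ≢ v → u ≡ b ⊎ u ≡ c
    only-bc u u≢a u≢a′ u≢v with everything u
    ... | here u≡v                                 = contradiction u≡v u≢v
    ... | there (here u≡a)                         = contradiction u≡a u≢a
    ... | there (there (here u≡a′))                = contradiction u≡a′ u≢a′
    ... | there (there (there (here u≡b)))         = inj₁ u≡b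
    ... | there (there (there (there (here u≡c)))) = inj₂ u≡c

    heavyVertexTRDF : HeavyVertexTRDF
    heavyVertexTRDF with neighbour-of-b | neighbour-of-c
    ... | inj₂ (inj₂ b~c) | _                = star v~a v~a′ only-a′ (inj₂ b~c) (inj₂ (~-sym b~c))
    ... | _                | inj₂ (inj₂ c~b) = star v~a v~a′ only-a′ (inj₂ (~-sym c~b)) (inj₂ c~b)
    ... | inj₁ b~a         | inj₁ c~a         = star v~a v~a′ only-a′ (inj₁ b~a) (inj₁ c~a)
    ... | inj₂ (inj₁ b~a′) | inj₂ (inj₁ c~a′) = star v~a′ v~a only-a (inj₁ b~a′) (inj₁ c~a′)
    ... | inj₁ b~a         | inj₂ (inj₁ c~a′) = cross v~a v~a′ only-bc b~a c~a′
    ... | inj₂ (inj₁ b~a′) | inj₁ c~a         = cross v~a′ v~a (λ u u≢a′ u≢a → only-bc u u≢a u≢a′) b~a′ c~a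

  heavyVertexTRDF : HeavyVertexTRDF
  heavyVertexTRDF with n≡5⇒degree-2-vertex G noIsolated n≡5
  ... | v , a , a′ , a≢a′ , v~a , v~a′ with any? (λ b → ¬? (b ≟ v) ×-dec ¬? (v ~? b))
  ...   | no none = ⊥-elim (noUniversal v λ x x≢v → decidable-stable (v ~? x) λ v≁x → none (x , x≢v , v≁x))
  ...   | yes (b , b≢v , v≁b) with any? (λ c → ¬? (c ≟ v) ×-dec ¬? (c ≟ b) ×-dec ¬? (v ~? c))
  ...     | yes (c , c≢v , c≢b , v≁c) = Spread.heavyVertexTRDF a≢a′ v~a v~a′ b≢v v≁b c≢v c≢b v≁c
  ...     | no none = ⊥-elim (noNearlyUniversal b≢v v≁b λ u u≢v u≢b →
                        decidable-stable (v ~? u) λ v≁u → none (u , u≢v , u≢b , v≁u))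

-- The characterisation

trCritical⇒nestedMinima⊎K2∪K : ∀ {n} (G : Graph n) → TRCritical 5 G →
  (TCritical 3 G × ∃[ S ] ∃[ T ] (MinDominating G S × MinTotalDominating G T × S ⊂ T)) ⊎ (∃[ m ] (3 ≤ m × IsK2∪K G m))
trCritical⇒nestedMinima⊎K2∪K G (noIsolated , (_ , f₀ , trdf₀ , f₀≡5 , minimal) , nonEdge , critical) =
  [ (λ (_ , _ , _ , nested) → inj₁ (nestedDomination⇒nestedMinima nonEdge dominates nested))
  , (λ (_ , _ , isolated) → inj₂ (isolatedEdge+clique⇒K2∪K G 5≤n isolated (isolatedEdge-clique dominates isolated)))
  ]′ structure
  where
  open Heavy G noIsolated minimal
  dominates : ∀ e → HasDominatingEdge (addEdge G e)
  dominates = addedEdge-dominates critical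
  structure : Structure G
  structure with any? (λ v → val (f₀ v) ≟ℕ 2)
  ... | yes (v , v↦2) = LightTRDF.structure G noDominatingEdge trdf₀ (≤-reflexive f₀≡5) v v↦2
  ... | no no2 with FiveVertices.heavyVertexTRDF G noIsolated minimal
                      (trans (sym (weight-const1 f₀ (no2⇒const1 G trdf₀ no2))) f₀≡5)
  ...   | f , trdf , light , v , v↦2 = LightTRDF.structure G noDominatingEdge trdf light v v↦2

proposition5p3 : ∀ {n} (G : Graph n) →
    (TRCritical 5 G ⇔
      ((TCritical 3 G × ∃[ S ] ∃[ T ] (MinDominating G S × MinTotalDominating G T × S ⊂ T))
       ⊎ (∃[ m ] (3 ≤ m × IsK2∪K G m))))
    × (∀ m → 3 ≤ m → IsK2∪K G m → TSupercritical 4 G)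
proposition5p3 G =
  mk⇔ (trCritical⇒nestedMinima⊎K2∪K G)
      [ (λ (tCritical , nested) → nestedMinima⇒trCritical G tCritical nested)
      , (λ (m , 3≤m , iso) → K2∪K⇒trCritical G m 3≤m iso) ]′ ,
  K2∪K⇒tSupercritical G
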